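{- Let $G$ be a connected finite simple graph with $p$ vertices and $q$ edges, and let $\mathcal{P}_G$ be its graphicahedron (defined in the context). Then $\mathcal{P}_G$ is a simple abstract polytope of rank $q$ with $p!$ vertices and $p!\,q!$ flags. Moreover, the symmetric group $S_p$, acting on $\mathcal{P}_G$ by $(K,\alpha)\mapsto (K,\alpha\gamma)$ for $\gamma\in S_p$ (and fixing the least face), acts by polytope automorphisms and simply transitively on the vertices of $\mathcal{P}_G$.
   Context: Let $G$ have vertex set $\{1,\dots,p\}$ and edge set $E(G)$ with $|E(G)|=q$. For an edge $e=\{i,j\}$ let $\tau_e=(i\;j)\in S_p$ be the corresponding transposition. For $K\subseteq E(G)$ let $T_K=\langle \tau_e : e\in K\rangle\le S_p$ (the trivial group if $K=\emptyset$). The graphicahedron $\mathcal{P}_G$ is the poset defined as follows: consider all pairs $(K,\alpha)$ with $K\subseteq E(G)$ and $\alpha\in S_p$, identified by $(K,\alpha)\sim(L,\beta)$ iff $K=L$ and $T_K\alpha=T_L\beta$ (equality of right cosets); order the classes by $(K,\alpha)\le (L,\beta)$ iff $K\subseteq L$ and $T_K\alpha\subseteq T_L\beta$; the rank of $(K,\alpha)$ is $|K|$; finally adjoin a least element of rank $-1$. Faces of rank $0$ are vertices. An abstract polytope of rank $n$ is a poset with a strictly monotone rank function onto $\{ -1,0,\dots,n\}$, having a least and a greatest element, in which every maximal chain (flag) has $n+2$ elements, which is strongly flag-connected (any two flags $\Phi,\Psi$ are joined by a sequence of flags, each containing $\Phi\cap\Psi$, consecutive ones differing in exactly one element), and which satisfies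 the diamond condition (whenever $F< H$ with ranks $j-1$ and $j+1$, there are exactly two faces of rank $j$ strictly between them). An abstract polytope of rank $q$ is simple if each vertex-figure (the section of faces $\ge$ a given vertex) is isomorphic to the face lattice of the $(q-1)$-simplex. -}

module Defs where

open import Level using (0ℓ)
open import Data.Nat using (ℕ) renaming (_+_ to _+ℕ_)
open import Data.Integer using (ℤ; +_; -1ℤ; 1ℤ; _+_; _-_) renaming (_≤_ to _≤ℤ_; _<_ to _<ℤ_)
open import Data.Fin using (Fin)
open import Data.Fin.Subset using (Subset; _∈_; _⊆_; ∣_∣)
open import Data.Fin.Permutation using (Permutation′; _⟨$⟩ʳ_; transpose; _∘ₚ_; flip)
  renaming (_≈_ to _≈ₚ_; id to idₚ)
open import Data.Product using (Σ; ∃; _×_; _,_; proj₁; proj₂)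
open import Data.Sum using (_⊎_)
open import Data.Unit using (⊤)
open import Data.Empty using (⊥)
open import Data.List using (List; length)
open import Data.List.Relation.Unary.Any using (Any)
open import Data.List.Relation.Unary.All using (All)
open import Data.List.Relation.Unary.Linked using (Linked)
open import Data.List.Relation.Binary.Pointwise using (Pointwise)
open import Relation.Nullary using (¬_)
open import Relation.Binary.Core using (Rel)
open import Relation.Binary.Structures using (IsPartialOrder)
open import Relation.Binary.PropositionalEquality using (_≡_; _≢_)
open import Function.Bundles using (_⇔_)

SameEdge : {p : ℕ} → Fin p × Fin p → Fin p × Fin p → Set
SameEdge (a , b) (c , d) = (a ≡ c × b ≡ d) ⊎ (a ≡ d × b ≡ c)

record SimpleGraph (p q : ℕ) : Set where
  field
    edge     : Fin q → Fin p × Fin p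
    loopless : ∀ e → proj₁ (edge e) ≢ proj₂ (edge e)
    noMulti  : ∀ e e′ → SameEdge (edge e) (edge e′) → e ≡ e′

module _ {p q : ℕ} (G : SimpleGraph p q) where
  open SimpleGraph G

  data Walk : Fin p → Fin p → Set where
    here  : ∀ x → Walk x x
    fwd   : ∀ e {y} → Walk (proj₂ (edge e)) y → Walk (proj₁ (edge e)) y
    bwd   : ∀ e {y} → Walk (proj₁ (edge e)) y → Walk (proj₂ (edge e)) y

  Connected : Set
  Connected = ∀ x y → Walk x y

-- The symmetric group S_p: permutations of Fin p, equal when pointwise
-- equal (_≈ₚ_).  Product  σ · τ  is composition "first τ, then σ".

_·_ : {p : ℕ} → Permutation′ p → Permutation′ p → Permutation′ p
σ · τ = τ ∘ₚ σ

module Graphicahedron {p q : ℕ} (G : SimpleGraph p q) where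
  open SimpleGraph G

  τ : Fin q → Permutation′ p
  τ e = transpose (proj₁ (edge e)) (proj₂ (edge e))

  -- T_K = subgroup of S_p generated by { τ_e : e ∈ K }
  -- (smallest subset containing the generators and the identity,
  --  closed under products, inverses, and equality of permutations)
  data InT (K : Subset q) : Permutation′ p → Set where
    gen  : ∀ e → e ∈ K → InT K (τ e)
    one  : InT K idₚ
    mul  : ∀ {σ ρ} → InT K σ → InT K ρ → InT K (σ · ρ)
    inv  : ∀ {σ} → InT K σ → InT K (flip σ)
    resp : ∀ {σ ρ} → σ ≈ₚ ρ → InT K σ → InT K ρ

  InCoset : Subset q → Permutation′ p → Permutation′ p → Set
  InCoset K α π = Σ (Permutation′ p) λ t → InT K t × π ≈ₚ (t · α)

  CosetIncl : Subset q → Permutation′ p → Subset q → Permutation′ p → Set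
  CosetIncl K α L β = ∀ π → InCoset K α π → InCoset L β π

  CosetEq : Subset q → Permutation′ p → Subset q → Permutation′ p → Set
  CosetEq K α L β = CosetIncl K α L β × CosetIncl L β K α

  -- faces: the adjoined least face, or a representative pair (K , α)
  data Face : Set where
    bot  : Face
    face : Subset q → Permutation′ p → Face

  _≈F_ : Face → Face → Set
  bot ≈F bot = ⊤
  bot ≈F face _ _ = ⊥
  face _ _ ≈F bot = ⊥
  face K α ≈F face L β = K ≡ L × CosetEq K α L β

  _≤F_ : Face → Face → Set
  bot ≤F _ = ⊤
  face _ _ ≤F bot = ⊥
  face K α ≤F face L β = K ⊆ L × CosetIncl K α L β

  rankF : Face → ℤ
  rankF bot = -1ℤ
  rankF (face K _) = + ∣ K ∣

  act : Permutation′ p → Face → Face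
  act γ bot = bot
  act γ (face K α) = face K (α · γ)

module PolytopeNotions {F : Set} (_≈_ _≤_ : Rel F 0ℓ) (rank : F → ℤ) where

  _<F_ : Rel F 0ℓ
  x <F y = x ≤ y × ¬ (x ≈ y)

  _∈L_ : F → List F → Set
  x ∈L L = Any (x ≈_) L

  Comparable : F → F → Set
  Comparable x y = x ≤ y ⊎ y ≤ x

  IsChain : List F → Set
  IsChain = Linked _<F_

  IsFlag : List F → Set
  IsFlag Φ = IsChain Φ × (∀ g → All (Comparable g) Φ → g ∈L Φ)

  DifferInOne : List F → List F → Set
  DifferInOne A B =
    (Σ F λ a → a ∈L A × ¬ (a ∈L B) × (∀ x → x ∈L A → ¬ (x ∈L B) → x ≈ a)) ×
    (Σ F λ b → b ∈L B × ¬ (b ∈L A) × (∀ x → x ∈L B → ¬ (x ∈L A) → x ≈ b))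

  ContainsMeet : List F → List F → List F → Set
  ContainsMeet Φ Ψ Φ′ = ∀ x → x ∈L Φ → x ∈L Ψ → x ∈L Φ′

  data FlagSeq (Φ Ψ : List F) : List F → Set where
    done : ∀ {Λ} → Pointwise _≈_ Λ Ψ → FlagSeq Φ Ψ Λ
    step : ∀ {Λ Λ′} → IsFlag Λ′ → DifferInOne Λ Λ′ → ContainsMeet Φ Ψ Λ′ →
           FlagSeq Φ Ψ Λ′ → FlagSeq Φ Ψ Λ

  StronglyFlagConnected : Set
  StronglyFlagConnected = ∀ Φ Ψ → IsFlag Φ → IsFlag Ψ → FlagSeq Φ Ψ Φ

  ExactlyTwoBetween : F → F → ℤ → Set
  ExactlyTwoBetween f h j =
    Σ F λ g₁ → Σ F λ g₂ → B g₁ × B g₂ × ¬ (g₁ ≈ g₂) ×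
      (∀ g → B g → g ≈ g₁ ⊎ g ≈ g₂)
    where
    B : F → Set
    B g = f <F g × g <F h × rank g ≡ j

  Diamond : Set
  Diamond = ∀ f h j → rank f ≡ j - 1ℤ → rank h ≡ j + 1ℤ → f <F h →
            ExactlyTwoBetween f h j

  record IsAbstractPolytope (n : ℕ) : Set where
    field
      isPartialOrder : IsPartialOrder _≈_ _≤_
      rank-resp      : ∀ x y → x ≈ y → rank x ≡ rank y
      rank-strict    : ∀ x y → x <F y → rank x <ℤ rank y
      rank-range     : ∀ x → -1ℤ ≤ℤ rank x × rank x ≤ℤ + n
      rank-onto      : ∀ r → -1ℤ ≤ℤ r → r ≤ℤ + n → Σ F λ x → rank x ≡ r
      least          : Σ F λ m → ∀ x → m ≤ x
      greatest       : Σ F λ M → ∀ x → x ≤ M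
      flag-size      : ∀ Φ → IsFlag Φ → length Φ ≡ n +ℕ 2
      flag-connected : StronglyFlagConnected
      diamond        : Diamond

  -- the vertex-figure at v (faces ≥ v) is isomorphic to the face lattice
  -- of the (n-1)-simplex, i.e. to all subsets of an n-set under inclusion
  VertexFigureIsSimplex : ℕ → F → Set
  VertexFigureIsSimplex n v =
    Σ (Subset n → F) λ φ →
      (∀ S → v ≤ φ S) ×
      (∀ S T → (S ⊆ T) ⇔ (φ S ≤ φ T)) ×
      (∀ g → v ≤ g → Σ (Subset n) λ S → φ S ≈ g)

  IsSimple : ℕ → Set
  IsSimple n = ∀ v → rank v ≡ + 0 → VertexFigureIsSimplex n v

  NumFacesWith : (F → Set) → ℕ → Set
  NumFacesWith P k =
    Σ (Fin k → F) λ f →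
      (∀ i → P (f i)) ×
      (∀ i j → f i ≈ f j → i ≡ j) ×
      (∀ x → P x → Σ (Fin k) λ i → f i ≈ x)

  NumFlags : ℕ → Set
  NumFlags k =
    Σ (Fin k → List F) λ f →
      (∀ i → IsFlag (f i)) ×
      (∀ i j → Pointwise _≈_ (f i) (f j) → i ≡ j) ×
      (∀ Φ → IsFlag Φ → Σ (Fin k) λ i → Pointwise _≈_ (f i) Φ)

  IsAutomorphism : (F → F) → Set
  IsAutomorphism f =
    (∀ x y → x ≈ y → f x ≈ f y) ×
    (∀ x y → (x ≤ y) ⇔ (f x ≤ f y)) ×
    (∀ y → Σ F λ x → f x ≈ y)

-- A flag of the graphicahedron is determined by a vertex α ∈ S_p and an
-- ordering σ of the q edges: its faces are (first i edges of σ, α) for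
-- i = 0 … q. This gives the rank q, the p! q! flags, the p! vertices (∅, α),
-- on which S_p acts regularly by right multiplication, and simple
-- vertex-figures, the faces above (∅, α) being the (S, α). Diamonds are
-- intervals of edge sets, except below an edge {e}, whose two vertices are
-- α and τ_e α. Two flags are joined through flags keeping their common
-- faces: below the least common rank c, with K the common set of c edges,
-- the vertex is changed by the generators τ_w of β α⁻¹ ∈ T_K one at a time
-- (moving w to the front of the order, then the vertex along it), and then
-- the edge order is bubble-sorted. As G is connected, T_E = S_p, so the top
-- face is always common.

module Submission where

open import Defs
open import Data.Nat using (ℕ; _!; _*_)
open import Data.Integer using (ℤ; +_)
open import Data.Product using (Σ; _×_; _,_)
open import Data.Fin.Permutation using (Permutation′) renaming (_≈_ to _≈ₚ_; id to idₚ)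
open import Relation.Binary.PropositionalEquality using (_≡_)
open import Level using (0ℓ)
open import Relation.Binary.Core using (Rel)
open import Relation.Binary.Structures using (IsPartialOrder)

module Permutations where
  open import Data.Fin using (Fin)
  open import Data.Fin.Properties using (_≟_)
  open import Data.Fin.Permutation
    using (_⟨$⟩ʳ_; _⟨$⟩ˡ_; transpose; flip; inverseˡ; inverseʳ)
  open import Data.Sum using (_⊎_; inj₁; inj₂)
  open import Function using (_∘_)
  open import Relation.Nullary using (Dec; yes; no)
  open import Relation.Nullary.Decidable using (dec-true; dec-false)
  open import Relation.Binary.PropositionalEquality

  Perm : ℕ → Set
  Perm = Permutation′

  -- Pointwise equality, wrapped in a record so that both permutations
  -- can be inferred from a proof.
  infix 4 _≋_
  record _≋_ {n : ℕ} (σ τ : Perm n) : Set where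
    constructor ⟪_⟫
    field ap : σ ≈ₚ τ
  open _≋_ public

  module _ {n : ℕ} where

    ≋-refl : {σ : Perm n} → σ ≋ σ
    ≋-refl = ⟪ (λ _ → refl) ⟫

    ≋-sym : {σ τ : Perm n} → σ ≋ τ → τ ≋ σ
    ≋-sym ⟪ e ⟫ = ⟪ (λ i → sym (e i)) ⟫

    ≋-trans : {σ τ ρ : Perm n} → σ ≋ τ → τ ≋ ρ → σ ≋ ρ
    ≋-trans ⟪ e ⟫ ⟪ f ⟫ = ⟪ (λ i → trans (e i) (f i)) ⟫

    ⟨$⟩ʳ-injective : (σ : Perm n) {i j : Fin n} → σ ⟨$⟩ʳ i ≡ σ ⟨$⟩ʳ j → i ≡ j
    ⟨$⟩ʳ-injective σ {i} {j} e = trans (sym (inverseˡ σ)) (trans (cong (σ ⟨$⟩ˡ_) e) (inverseˡ σ))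

    ·-cong : {σ σ′ τ τ′ : Perm n} → σ ≋ σ′ → τ ≋ τ′ → σ · τ ≋ σ′ · τ′
    ·-cong {σ} ⟪ e ⟫ ⟪ f ⟫ = ⟪ (λ i → trans (cong (σ ⟨$⟩ʳ_) (f i)) (e _)) ⟫

    ·-congˡ : {σ σ′ : Perm n} (τ : Perm n) → σ ≋ σ′ → σ · τ ≋ σ′ · τ
    ·-congˡ {σ} {σ′} τ e = ·-cong {σ} {σ′} {τ} {τ} e ≋-refl

    ·-congʳ : (σ : Perm n) {τ τ′ : Perm n} → τ ≋ τ′ → σ · τ ≋ σ · τ′
    ·-congʳ σ {τ} {τ′} f = ·-cong {σ} {σ} {τ} {τ′} ≋-refl f

    ·-assoc : (σ τ ρ : Perm n) → (σ · τ) · ρ ≋ σ · (τ · ρ)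
    ·-assoc σ τ ρ = ≋-refl

    ·-identityʳ : (σ : Perm n) → σ · idₚ ≋ σ
    ·-identityʳ σ = ≋-refl

    ·-inverseˡ : (σ : Perm n) → flip σ · σ ≋ idₚ
    ·-inverseˡ σ = ⟪ (λ _ → inverseˡ σ) ⟫

    ·-inverseʳ : (σ : Perm n) → σ · flip σ ≋ idₚ
    ·-inverseʳ σ = ⟪ (λ _ → inverseʳ σ) ⟫

    flip-cong : {σ τ : Perm n} → σ ≋ τ → flip σ ≋ flip τ
    flip-cong {σ} {τ} ⟪ e ⟫ =
      ⟪ (λ i → trans (sym (inverseˡ τ)) (cong (τ ⟨$⟩ˡ_) (trans (sym (e _)) (inverseʳ σ)))) ⟫

    ·-cancelˡ : (σ : Perm n) {γ δ : Perm n} → σ · γ ≋ σ · δ → γ ≋ δ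
    ·-cancelˡ σ ⟪ e ⟫ = ⟪ (λ i → ⟨$⟩ʳ-injective σ (e i)) ⟫

    ·-cancelʳ : (σ : Perm n) {γ δ : Perm n} → γ · σ ≋ δ · σ → γ ≋ δ
    ·-cancelʳ σ {γ} {δ} ⟪ e ⟫ =
      ⟪ (λ i → trans (cong (γ ⟨$⟩ʳ_) (sym (inverseʳ σ))) (trans (e _) (cong (δ ⟨$⟩ʳ_) (inverseʳ σ)))) ⟫

    ·flip≋id⇒≋ : {σ τ : Perm n} → σ · flip τ ≋ idₚ → σ ≋ τ
    ·flip≋id⇒≋ {σ} {τ} ⟪ e ⟫ = ⟪ (λ i → trans (cong (σ ⟨$⟩ʳ_) (sym (inverseˡ τ))) (e _)) ⟫

    fst⊎snd⊎other : (i j k : Fin n) → k ≡ i ⊎ k ≡ j ⊎ (k ≢ i × k ≢ j)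
    fst⊎snd⊎other i j k with k ≟ i | k ≟ j
    ... | yes k≡i | _       = inj₁ k≡i
    ... | no _    | yes k≡j = inj₂ (inj₁ k≡j)
    ... | no k≢i  | no k≢j  = inj₂ (inj₂ (k≢i , k≢j))

    transpose-fst : (i j : Fin n) → transpose i j ⟨$⟩ʳ i ≡ j
    transpose-fst i j rewrite dec-true (i ≟ i) refl = refl

    transpose-snd : (i j : Fin n) → transpose i j ⟨$⟩ʳ j ≡ i
    transpose-snd i j with j ≟ i
    ... | yes j≡i = j≡i
    ... | no _ rewrite dec-true (j ≟ j) refl = refl

    transpose-other : (i j k : Fin n) → k ≢ i → k ≢ j → transpose i j ⟨$⟩ʳ k ≡ k
    transpose-other i j k k≢i k≢j rewrite dec-false (k ≟ i) k≢i | dec-false (k ≟ j) k≢j = refl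

    transpose-comm : (i j : Fin n) → transpose i j ≋ transpose j i
    transpose-comm i j = ⟪ pointwise ⟫
      where
      pointwise : ∀ k → transpose i j ⟨$⟩ʳ k ≡ transpose j i ⟨$⟩ʳ k
      pointwise k with fst⊎snd⊎other i j k
      ... | inj₁ refl = trans (transpose-fst k j) (sym (transpose-snd j k))
      ... | inj₂ (inj₁ refl) = trans (transpose-snd i k) (sym (transpose-fst k i))
      ... | inj₂ (inj₂ (k≢i , k≢j)) =
        trans (transpose-other i j k k≢i k≢j) (sym (transpose-other j i k k≢j k≢i))

    flip-transpose : (i j : Fin n) → flip (transpose i j) ≋ transpose i j
    flip-transpose i j = ≋-sym (transpose-comm i j)

    transpose-involutive : (i j : Fin n) → transpose i j · transpose i j ≋ idₚ
    transpose-involutive i j =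
      ≋-trans (·-congˡ (transpose i j) (≋-sym (flip-transpose i j))) (·-inverseˡ (transpose i j))

    transpose-self : (i : Fin n) → transpose i i ≋ idₚ
    transpose-self i = ⟪ pointwise ⟫
      where
      pointwise : ∀ k → transpose i i ⟨$⟩ʳ k ≡ k
      pointwise k with fst⊎snd⊎other i i k
      ... | inj₁ refl = transpose-fst k k
      ... | inj₂ (inj₁ refl) = transpose-fst k k
      ... | inj₂ (inj₂ (k≢i , _)) = transpose-other i i k k≢i k≢i

    transpose-conjugate : (a b y : Fin n) → a ≢ b → a ≢ y → b ≢ y →
                          transpose a b · (transpose b y · transpose a b) ≋ transpose a y
    transpose-conjugate a b y a≢b a≢y b≢y = ⟪ pointwise ⟫
      where
      pointwise : ∀ k → transpose a b ⟨$⟩ʳ (transpose b y ⟨$⟩ʳ (transpose a b ⟨$⟩ʳ k))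
                        ≡ transpose a y ⟨$⟩ʳ k
      pointwise k = by-cases (k ≟ a) (k ≟ b) (k ≟ y)
        where
        by-cases : Dec (k ≡ a) → Dec (k ≡ b) → Dec (k ≡ y) →
                   transpose a b ⟨$⟩ʳ (transpose b y ⟨$⟩ʳ (transpose a b ⟨$⟩ʳ k))
                   ≡ transpose a y ⟨$⟩ʳ k
        by-cases (yes refl) _ _
          rewrite transpose-fst k b | transpose-fst b y | transpose-fst k y
                | transpose-other k b y (a≢y ∘ sym) (b≢y ∘ sym) = refl
        by-cases (no k≢a) (yes refl) _
          rewrite transpose-snd a k | transpose-other k y a a≢b a≢y | transpose-fst a k
                | transpose-other a y k k≢a b≢y = refl
        by-cases (no k≢a) (no k≢b) (yes refl)
          rewrite transpose-other a b k k≢a k≢b | transpose-snd b k | transpose-snd a b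
                | transpose-snd a k = refl
        by-cases (no k≢a) (no k≢b) (no k≢y)
          rewrite transpose-other a b k k≢a k≢b | transpose-other b y k k≢b k≢y
                | transpose-other a b k k≢a k≢b | transpose-other a y k k≢a k≢y = refl


module FinSubsets where
  open import Data.Nat using (suc; _<_)
  open import Data.Nat.Properties using (<-irrefl; <⇒≱; m<n⇒m<1+n; n<1+n)
  open import Data.Fin using (Fin; zero; suc)
  open import Data.Fin.Properties using (any?)
  open import Data.Fin.Subset
  open import Data.Fin.Subset.Properties
  open import Data.Vec using (_∷_; here; there; tabulate)
  open import Data.Vec.Properties using (lookup⇒[]=; []=⇒lookup; lookup∘tabulate)
  open import Data.Bool using (true; false)
  open import Data.Product using (∃; proj₁; proj₂)
  open import Data.Sum using (_⊎_; inj₁; inj₂)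
  open import Data.Empty using (⊥-elim)
  open import Relation.Nullary using (¬_; Dec; yes; no; does)
  open import Relation.Nullary.Decidable using (_×-dec_; ¬?; dec-true)
  open import Relation.Unary using (Decidable)
  open import Relation.Binary.PropositionalEquality
  open import Function using (_∘_)

  private variable
    n : ℕ
    p q r : Subset n

  satisfying : {P : Fin n → Set} → Decidable P → Subset n
  satisfying P? = tabulate (does ∘ P?)

  ∈satisfying⁺ : {P : Fin n → Set} (P? : Decidable P) {x : Fin n} → P x → x ∈ satisfying P?
  ∈satisfying⁺ P? {x} Px = lookup⇒[]= x _ (trans (lookup∘tabulate (does ∘ P?) x) (dec-true (P? x) Px))

  ∈satisfying⁻ : {P : Fin n → Set} (P? : Decidable P) {x : Fin n} → x ∈ satisfying P? → P x
  ∈satisfying⁻ P? {x} x∈ = witness (P? x) (trans (sym (lookup∘tabulate (does ∘ P?) x)) ([]=⇒lookup x∈))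
    where
    witness : ∀ {A : Set} (A? : Dec A) → does A? ≡ true → A
    witness (yes a) _ = a

  private
    ⊈-witness⊎⊇ : (p q : Subset n) → (∃ λ x → x ∈ q × x ∉ p) ⊎ q ⊆ p
    ⊈-witness⊎⊇ p q with any? (λ x → (x ∈? q) ×-dec ¬? (x ∈? p))
    ... | yes witness = inj₁ witness
    ... | no none = inj₂ λ {x} x∈q → decide x x∈q (x ∈? p)
      where
      decide : ∀ x → x ∈ q → Dec (x ∈ p) → x ∈ p
      decide x x∈q (yes x∈p) = x∈p
      decide x x∈q (no x∉p) = ⊥-elim (none (x , x∈q , x∉p))

  p⊆q⇒∣p∣≡∣q∣⇒p≡q : p ⊆ q → ∣ p ∣ ≡ ∣ q ∣ → p ≡ q
  p⊆q⇒∣p∣≡∣q∣⇒p≡q {p = p} {q} p⊆q eq with ⊈-witness⊎⊇ p q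
  ... | inj₂ q⊆p = ⊆-antisym p⊆q q⊆p
  ... | inj₁ missing = ⊥-elim (<-irrefl eq (p⊂q⇒∣p∣<∣q∣ (p⊆q , missing)))

  p⊆q⇒∣p∣<∣q∣⇒p⊂q : p ⊆ q → ∣ p ∣ < ∣ q ∣ → p ⊂ q
  p⊆q⇒∣p∣<∣q∣⇒p⊂q {p = p} {q} p⊆q lt with ⊈-witness⊎⊇ p q
  ... | inj₁ missing = p⊆q , missing
  ... | inj₂ q⊆p = ⊥-elim (<⇒≱ lt (p⊆q⇒∣p∣≤∣q∣ q⊆p))

  ∣p∣≡0⇒p≡⊥ : ∣ p ∣ ≡ 0 → p ≡ ⊥
  ∣p∣≡0⇒p≡⊥ {n} eq = sym (p⊆q⇒∣p∣≡∣q∣⇒p≡q ⊥⊆ (trans (∣⊥∣≡0 n) (sym eq)))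

  y∈p∪⁅y⁆ : (y : Fin n) → y ∈ p ∪ ⁅ y ⁆
  y∈p∪⁅y⁆ {p = p} y = q⊆p∪q p ⁅ y ⁆ (x∈⁅x⁆ y)

  x∈p∪⁅y⁆⇒x∈p⊎x≡y : ∀ {x} (y : Fin n) → x ∈ p ∪ ⁅ y ⁆ → x ∈ p ⊎ x ≡ y
  x∈p∪⁅y⁆⇒x∈p⊎x≡y {p = p} y x∈ with x∈p∪q⁻ p ⁅ y ⁆ x∈
  ... | inj₁ x∈p = inj₁ x∈p
  ... | inj₂ x∈⁅y⁆ = inj₂ (x∈⁅y⁆⇒x≡y y x∈⁅y⁆)

  p⊆r⇒y∈r⇒p∪⁅y⁆⊆r : ∀ {y} → p ⊆ r → y ∈ r → p ∪ ⁅ y ⁆ ⊆ r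
  p⊆r⇒y∈r⇒p∪⁅y⁆⊆r {p = p} {y = y} p⊆r y∈r x∈ with x∈p∪⁅y⁆⇒x∈p⊎x≡y y x∈
  ... | inj₁ x∈p = p⊆r x∈p
  ... | inj₂ refl = y∈r

  x∉p⇒∣p∪⁅x⁆∣≡1+∣p∣ : ∀ {x} (p : Subset n) → x ∉ p → ∣ p ∪ ⁅ x ⁆ ∣ ≡ suc ∣ p ∣
  x∉p⇒∣p∪⁅x⁆∣≡1+∣p∣ {x = zero} (true ∷ p) x∉ = ⊥-elim (x∉ here)
  x∉p⇒∣p∪⁅x⁆∣≡1+∣p∣ {x = zero} (false ∷ p) x∉ = cong suc (cong ∣_∣ (∪-identityʳ p))
  x∉p⇒∣p∪⁅x⁆∣≡1+∣p∣ {x = suc x} (true ∷ p) x∉ = cong suc (x∉p⇒∣p∪⁅x⁆∣≡1+∣p∣ p (x∉ ∘ there))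
  x∉p⇒∣p∪⁅x⁆∣≡1+∣p∣ {x = suc x} (false ∷ p) x∉ = x∉p⇒∣p∪⁅x⁆∣≡1+∣p∣ p (x∉ ∘ there)

  p⊂q⇒∣q∣≡1+∣p∣⇒q≡p∪⁅x⁆ : ∀ {x} → p ⊆ q → x ∈ q → x ∉ p → ∣ q ∣ ≡ suc ∣ p ∣ → q ≡ p ∪ ⁅ x ⁆
  p⊂q⇒∣q∣≡1+∣p∣⇒q≡p∪⁅x⁆ {p = p} p⊆q x∈q x∉p eq =
    sym (p⊆q⇒∣p∣≡∣q∣⇒p≡q (p⊆r⇒y∈r⇒p∪⁅y⁆⊆r p⊆q x∈q) (trans (x∉p⇒∣p∪⁅x⁆∣≡1+∣p∣ p x∉p) (sym eq)))

  ∣p∣≡1⇒p≡⁅x⁆ : ∣ p ∣ ≡ 1 → ∃ λ x → p ≡ ⁅ x ⁆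
  ∣p∣≡1⇒p≡⁅x⁆ {n} {p} eq with p⊆q⇒∣p∣<∣q∣⇒p⊂q {p = ⊥} {p} ⊥⊆ (subst₂ _<_ (sym (∣⊥∣≡0 n)) (sym eq) (n<1+n 0))
  ... | _ , x , x∈p , x∉⊥ =
    x , trans (p⊂q⇒∣q∣≡1+∣p∣⇒q≡p∪⁅x⁆ ⊥⊆ x∈p x∉⊥ (trans eq (cong suc (sym (∣⊥∣≡0 n)))))
              (∪-identityˡ ⁅ x ⁆)

  record SubsetDiamond (p q : Subset n) : Set where
    field
      a b      : Fin n
      a∉p      : a ∉ p
      b∉p      : b ∉ p
      a≢b      : a ≢ b
      p∪⁅a⁆⊆q  : p ∪ ⁅ a ⁆ ⊆ q
      p∪⁅b⁆⊆q  : p ∪ ⁅ b ⁆ ⊆ q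
      only-a-b : ∀ r → p ⊆ r → r ⊆ q → ∣ r ∣ ≡ suc ∣ p ∣ → r ≡ p ∪ ⁅ a ⁆ ⊎ r ≡ p ∪ ⁅ b ⁆

  subsetDiamond : p ⊆ q → ∣ q ∣ ≡ suc (suc ∣ p ∣) → SubsetDiamond p q
  subsetDiamond {p = p} {q} p⊆q ∣q∣≡ = record
    { a = a ; b = b ; a∉p = a∉p ; b∉p = b∉p ; a≢b = a≢b
    ; p∪⁅a⁆⊆q = pa⊆q ; p∪⁅b⁆⊆q = p⊆r⇒y∈r⇒p∪⁅y⁆⊆r p⊆q b∈q ; only-a-b = only-a-b }
    where
    ∣p∣<∣q∣ : ∣ p ∣ < ∣ q ∣
    ∣p∣<∣q∣ = subst (∣ p ∣ <_) (sym ∣q∣≡) (m<n⇒m<1+n (n<1+n ∣ p ∣))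
    a = proj₁ (proj₂ (p⊆q⇒∣p∣<∣q∣⇒p⊂q p⊆q ∣p∣<∣q∣))
    a∉p = proj₂ (proj₂ (proj₂ (p⊆q⇒∣p∣<∣q∣⇒p⊂q p⊆q ∣p∣<∣q∣)))
    pa⊆q : p ∪ ⁅ a ⁆ ⊆ q
    pa⊆q = p⊆r⇒y∈r⇒p∪⁅y⁆⊆r p⊆q (proj₁ (proj₂ (proj₂ (p⊆q⇒∣p∣<∣q∣⇒p⊂q p⊆q ∣p∣<∣q∣))))
    ∣pa∣≡ : ∣ p ∪ ⁅ a ⁆ ∣ ≡ suc ∣ p ∣
    ∣pa∣≡ = x∉p⇒∣p∪⁅x⁆∣≡1+∣p∣ p a∉p
    ∣pa∣<∣q∣ : ∣ p ∪ ⁅ a ⁆ ∣ < ∣ q ∣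
    ∣pa∣<∣q∣ = subst₂ _<_ (sym ∣pa∣≡) (sym ∣q∣≡) (n<1+n (suc ∣ p ∣))
    b = proj₁ (proj₂ (p⊆q⇒∣p∣<∣q∣⇒p⊂q pa⊆q ∣pa∣<∣q∣))
    b∈q = proj₁ (proj₂ (proj₂ (p⊆q⇒∣p∣<∣q∣⇒p⊂q pa⊆q ∣pa∣<∣q∣)))
    b∉pa = proj₂ (proj₂ (proj₂ (p⊆q⇒∣p∣<∣q∣⇒p⊂q pa⊆q ∣pa∣<∣q∣)))
    b∉p : b ∉ p
    b∉p b∈p = b∉pa (p⊆p∪q ⁅ a ⁆ b∈p)
    a≢b : a ≢ b
    a≢b a≡b = b∉pa (subst (_∈ p ∪ ⁅ a ⁆) a≡b (y∈p∪⁅y⁆ a))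
    q≡pab : q ≡ (p ∪ ⁅ a ⁆) ∪ ⁅ b ⁆
    q≡pab = p⊂q⇒∣q∣≡1+∣p∣⇒q≡p∪⁅x⁆ pa⊆q b∈q b∉pa (trans ∣q∣≡ (cong suc (sym ∣pa∣≡)))
    only-a-b : ∀ r → p ⊆ r → r ⊆ q → ∣ r ∣ ≡ suc ∣ p ∣ → r ≡ p ∪ ⁅ a ⁆ ⊎ r ≡ p ∪ ⁅ b ⁆
    only-a-b r p⊆r r⊆q ∣r∣≡
      with p⊆q⇒∣p∣<∣q∣⇒p⊂q p⊆r (subst (∣ p ∣ <_) (sym ∣r∣≡) (n<1+n _))
    ... | _ , x , x∈r , x∉p with x∈p∪⁅y⁆⇒x∈p⊎x≡y b (subst (x ∈_) q≡pab (r⊆q x∈r))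
    ... | inj₂ refl = inj₂ (p⊂q⇒∣q∣≡1+∣p∣⇒q≡p∪⁅x⁆ p⊆r x∈r x∉p ∣r∣≡)
    ... | inj₁ x∈pa with x∈p∪⁅y⁆⇒x∈p⊎x≡y a x∈pa
    ...   | inj₁ x∈p = ⊥-elim (x∉p x∈p)
    ...   | inj₂ refl = inj₁ (p⊂q⇒∣q∣≡1+∣p∣⇒q≡p∪⁅x⁆ p⊆r x∈r x∉p ∣r∣≡)


module PrefixSubsets where
  open Permutations
  open FinSubsets
  open import Data.Nat using (zero; suc; _+_; _∸_; _≤_; _<_; _<?_; z≤n)
  open import Data.Nat.Properties
    using (<-irrefl; <⇒≱; <⇒≤; <-≤-trans; ≤-pred; ≤-refl; n≤1+n; n<1+n; m<n⇒m<1+n; m≤n⇒m<n∨m≡n;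
           m∸n+n≡m; <-cmp; <-trans; ≤∧≢⇒<)
  open import Data.Fin using (Fin; toℕ; fromℕ<)
  open import Data.Fin.Properties using (toℕ-fromℕ<; toℕ<n; toℕ-injective)
  open import Data.Fin.Permutation using (_⟨$⟩ʳ_; _⟨$⟩ˡ_; inverseˡ; inverseʳ; permutation; transpose)
  open import Data.Fin.Permutation.Components using (transpose-inverse)
  open import Function using (_∘_)
  open import Data.Fin.Subset using (Subset; _∈_; _∉_; _⊆_; ∣_∣; ⁅_⁆; _∪_; ⊤; ⊥)
  open import Data.Fin.Subset.Properties
    using (⊆-antisym; ∣p∣≡n⇒p≡⊤; ∈⊤; ⊆⊤; ⊥⊆; ∉⊥; ∣⊥∣≡0; p⊆p∪q; _∈?_)
  open import Data.Product using (∃; proj₁; proj₂)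
  open import Data.Sum using (inj₁; inj₂)
  open import Data.Empty using (⊥-elim)
  open import Relation.Nullary using (yes; no)
  open import Relation.Binary.PropositionalEquality
  open import Relation.Binary.Definitions using (tri<; tri≈; tri>)

  private variable q : ℕ

  -- σ lists the q edges in order: σ ⟨$⟩ʳ i is the edge in position i.
  position : Perm q → Fin q → ℕ
  position σ e = toℕ (σ ⟨$⟩ˡ e)

  prefix : Perm q → ℕ → Subset q
  prefix σ r = satisfying (λ e → position σ e <? r)

  module _ (σ : Perm q) where

    position-⟨$⟩ʳ : ∀ i → position σ (σ ⟨$⟩ʳ i) ≡ toℕ i
    position-⟨$⟩ʳ i = cong toℕ (inverseˡ σ)

    ∈prefix⇒position< : ∀ {r e} → e ∈ prefix σ r → position σ e < r
    ∈prefix⇒position< {r} = ∈satisfying⁻ (λ e → position σ e <? r)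

    position<⇒∈prefix : ∀ {r e} → position σ e < r → e ∈ prefix σ r
    position<⇒∈prefix {r} = ∈satisfying⁺ (λ e → position σ e <? r)

    prefix-mono : ∀ {r s} → r ≤ s → prefix σ r ⊆ prefix σ s
    prefix-mono r≤s e∈ = position<⇒∈prefix (<-≤-trans (∈prefix⇒position< e∈) r≤s)

    prefix-zero : prefix σ 0 ≡ ⊥
    prefix-zero = ⊆-antisym (λ e∈ → ⊥-elim (<⇒≱ (∈prefix⇒position< e∈) z≤n)) ⊥⊆

    prefix-full : prefix σ q ≡ ⊤
    prefix-full = ⊆-antisym ⊆⊤ (λ {e} _ → position<⇒∈prefix (toℕ<n (σ ⟨$⟩ˡ e)))

    prefix-suc : ∀ r (r<q : r < q) → prefix σ (suc r) ≡ prefix σ r ∪ ⁅ σ ⟨$⟩ʳ fromℕ< r<q ⁆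
    prefix-suc r r<q = ⊆-antisym to from
      where
      x = σ ⟨$⟩ʳ fromℕ< r<q
      to : prefix σ (suc r) ⊆ prefix σ r ∪ ⁅ x ⁆
      to {e} e∈ with m≤n⇒m<n∨m≡n (≤-pred (∈prefix⇒position< e∈))
      ... | inj₁ lt = p⊆p∪q ⁅ x ⁆ (position<⇒∈prefix lt)
      ... | inj₂ eq = subst (_∈ prefix σ r ∪ ⁅ x ⁆) x≡e (y∈p∪⁅y⁆ x)
        where
        x≡e : x ≡ e
        x≡e = trans (cong (σ ⟨$⟩ʳ_) (toℕ-injective (trans (toℕ-fromℕ< r<q) (sym eq)))) (inverseʳ σ)
      from : prefix σ r ∪ ⁅ x ⁆ ⊆ prefix σ (suc r)
      from e∈ with x∈p∪⁅y⁆⇒x∈p⊎x≡y x e∈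
      ... | inj₁ e∈p = prefix-mono (n≤1+n r) e∈p
      ... | inj₂ refl = position<⇒∈prefix
                          (subst (_< suc r) (sym (trans (position-⟨$⟩ʳ (fromℕ< r<q)) (toℕ-fromℕ< r<q))) (n<1+n r))

    ∣prefix∣≡ : ∀ r → r ≤ q → ∣ prefix σ r ∣ ≡ r
    ∣prefix∣≡ zero _ = trans (cong ∣_∣ prefix-zero) (∣⊥∣≡0 q)
    ∣prefix∣≡ (suc r) r<q = begin
      ∣ prefix σ (suc r) ∣                    ≡⟨ cong ∣_∣ (prefix-suc r r<q) ⟩
      ∣ prefix σ r ∪ ⁅ σ ⟨$⟩ʳ fromℕ< r<q ⁆ ∣  ≡⟨ x∉p⇒∣p∪⁅x⁆∣≡1+∣p∣ (prefix σ r) x∉ ⟩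
      suc ∣ prefix σ r ∣                      ≡⟨ cong suc (∣prefix∣≡ r (<⇒≤ r<q)) ⟩
      suc r                                   ∎
      where
      open ≡-Reasoning
      x∉ : σ ⟨$⟩ʳ fromℕ< r<q ∉ prefix σ r
      x∉ x∈ = <-irrefl (trans (position-⟨$⟩ʳ (fromℕ< r<q)) (toℕ-fromℕ< r<q)) (∈prefix⇒position< x∈)

  prefix-cong : ∀ {σ σ′ : Perm q} → σ ≋ σ′ → ∀ r → prefix σ r ≡ prefix σ′ r
  prefix-cong {σ = σ} {σ′} σ≋σ′ r = ⊆-antisym
    (λ {e} e∈ → position<⇒∈prefix σ′ (subst (_< r) (same e) (∈prefix⇒position< σ e∈)))
    (λ {e} e∈ → position<⇒∈prefix σ (subst (_< r) (sym (same e)) (∈prefix⇒position< σ′ e∈)))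
    where
    same : ∀ e → position σ e ≡ position σ′ e
    same e = cong toℕ (ap (flip-cong σ≋σ′) e)

  -- The edge in position i is the one entering the prefix at step i + 1.
  prefix-injective : ∀ {σ σ′ : Perm q} → (∀ r → r ≤ q → prefix σ r ≡ prefix σ′ r) → σ ≋ σ′
  prefix-injective {q} {σ} {σ′} same = ⟪ pointwise ⟫
    where
    pointwise : ∀ i → σ ⟨$⟩ʳ i ≡ σ′ ⟨$⟩ʳ i
    pointwise i = trans (sym (inverseʳ σ′)) (cong (σ′ ⟨$⟩ʳ_) (toℕ-injective position′≡i))
      where
      e = σ ⟨$⟩ʳ i
      e∈ : e ∈ prefix σ′ (suc (toℕ i))
      e∈ = subst (e ∈_) (same (suc (toℕ i)) (toℕ<n i))
             (position<⇒∈prefix σ (subst (_< suc (toℕ i)) (sym (position-⟨$⟩ʳ σ i)) (n<1+n _)))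
      e∉ : e ∉ prefix σ′ (toℕ i)
      e∉ e∈′ = <-irrefl (position-⟨$⟩ʳ σ i)
                 (∈prefix⇒position< σ (subst (e ∈_) (sym (same (toℕ i) (<⇒≤ (toℕ<n i)))) e∈′))
      position′≡i : position σ′ e ≡ toℕ i
      position′≡i with <-cmp (position σ′ e) (toℕ i)
      ... | tri< lt _ _ = ⊥-elim (e∉ (position<⇒∈prefix σ′ lt))
      ... | tri≈ _ eq _ = eq
      ... | tri> _ _ gt = ⊥-elim (<⇒≱ gt (≤-pred (∈prefix⇒position< σ′ e∈)))

  -- The edge in position i is the one added in K (i + 1).
  module _ (K : ℕ → Subset q) (K-step : ∀ i → K i ⊆ K (suc i))
           (∣K∣≡ : ∀ i → i ≤ q → ∣ K i ∣ ≡ i) where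

    private
      K-mono : ∀ {i j} → i ≤ j → K i ⊆ K j
      K-mono {i} {j} i≤j = subst (λ k → K i ⊆ K k) (m∸n+n≡m i≤j) (go (j ∸ i))
        where
        go : ∀ d → K i ⊆ K (d + i)
        go zero e∈ = e∈
        go (suc d) e∈ = K-step (d + i) (go d e∈)

      K-grows : ∀ (i : Fin q) → ∣ K (toℕ i) ∣ < ∣ K (suc (toℕ i)) ∣
      K-grows i = subst₂ _<_ (sym (∣K∣≡ (toℕ i) (<⇒≤ (toℕ<n i)))) (sym (∣K∣≡ (suc (toℕ i)) (toℕ<n i)))
                    (n<1+n _)

      new : (i : Fin q) → ∃ λ e → e ∈ K (suc (toℕ i)) × e ∉ K (toℕ i)
      new i = proj₂ (p⊆q⇒∣p∣<∣q∣⇒p⊂q (K-step (toℕ i)) (K-grows i))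

      edgeAt : Fin q → Fin q
      edgeAt i = proj₁ (new i)

      new-unique : ∀ (i : Fin q) e → e ∈ K (suc (toℕ i)) → e ∉ K (toℕ i) → e ≡ edgeAt i
      new-unique i e e∈ e∉ with x∈p∪⁅y⁆⇒x∈p⊎x≡y (edgeAt i) (subst (e ∈_) K≡ e∈)
        where
        K≡ : K (suc (toℕ i)) ≡ K (toℕ i) ∪ ⁅ edgeAt i ⁆
        K≡ = p⊂q⇒∣q∣≡1+∣p∣⇒q≡p∪⁅x⁆ (K-step (toℕ i)) (proj₁ (proj₂ (new i))) (proj₂ (proj₂ (new i)))
               (trans (∣K∣≡ (suc (toℕ i)) (toℕ<n i)) (cong suc (sym (∣K∣≡ (toℕ i) (<⇒≤ (toℕ<n i))))))
      ... | inj₁ e∈K = ⊥-elim (e∉ e∈K)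
      ... | inj₂ e≡ = e≡

      K0-empty : ∀ e → e ∉ K 0
      K0-empty e e∈ = ∉⊥ (subst (e ∈_) (∣p∣≡0⇒p≡⊥ (∣K∣≡ 0 z≤n)) e∈)

      entry : ∀ r e → e ∈ K r → ∃ λ i → i < r × e ∈ K (suc i) × e ∉ K i
      entry zero e e∈ = ⊥-elim (K0-empty e e∈)
      entry (suc r) e e∈ with e ∈? K r
      ... | yes e∈′ = let (i , i<r , e∈i , e∉i) = entry r e e∈′ in i , m<n⇒m<1+n i<r , e∈i , e∉i
      ... | no e∉ = r , n<1+n r , e∈ , e∉

      e∈Kq : ∀ e → e ∈ K q
      e∈Kq e = subst (e ∈_) (sym (∣p∣≡n⇒p≡⊤ (∣K∣≡ q ≤-refl))) ∈⊤

      positionOf : Fin q → Fin q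
      positionOf e = fromℕ< (proj₁ (proj₂ (entry q e (e∈Kq e))))

      e∈K[1+positionOf] : ∀ e → e ∈ K (suc (toℕ (positionOf e)))
      e∈K[1+positionOf] e = subst (λ i → e ∈ K (suc i)) (sym (toℕ-fromℕ< _))
                              (proj₁ (proj₂ (proj₂ (entry q e (e∈Kq e)))))

      e∉K[positionOf] : ∀ e → e ∉ K (toℕ (positionOf e))
      e∉K[positionOf] e = subst (λ i → e ∉ K i) (sym (toℕ-fromℕ< _))
                            (proj₂ (proj₂ (proj₂ (entry q e (e∈Kq e)))))

      edgeAt-positionOf : ∀ e → edgeAt (positionOf e) ≡ e
      edgeAt-positionOf e = sym (new-unique (positionOf e) e (e∈K[1+positionOf] e) (e∉K[positionOf] e))

      positionOf-edgeAt : ∀ i → positionOf (edgeAt i) ≡ i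
      positionOf-edgeAt i = toℕ-injective same
        where
        e = edgeAt i
        same : toℕ (positionOf e) ≡ toℕ i
        same with <-cmp (toℕ (positionOf e)) (toℕ i)
        ... | tri< lt _ _ = ⊥-elim (proj₂ (proj₂ (new i)) (K-mono lt (e∈K[1+positionOf] e)))
        ... | tri≈ _ eq _ = eq
        ... | tri> _ _ gt = ⊥-elim (e∉K[positionOf] e (K-mono gt (proj₁ (proj₂ (new i)))))

      ordering : Perm q
      ordering = permutation edgeAt positionOf edgeAt-positionOf positionOf-edgeAt

      prefix-ordering : ∀ r → prefix ordering r ≡ K r
      prefix-ordering r = ⊆-antisym to from
        where
        to : prefix ordering r ⊆ K r
        to {e} e∈ = K-mono (∈prefix⇒position< ordering e∈) (e∈K[1+positionOf] e)
        from : K r ⊆ prefix ordering r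
        from {e} e∈ with <-cmp (toℕ (positionOf e)) r
        ... | tri< lt _ _ = position<⇒∈prefix ordering lt
        ... | tri≈ _ refl _ = ⊥-elim (e∉K[positionOf] e e∈)
        ... | tri> _ _ gt = ⊥-elim (e∉K[positionOf] e (K-mono (<⇒≤ gt) e∈))

    fullChain⇒prefixes : ∃ λ σ → ∀ r → prefix σ r ≡ K r
    fullChain⇒prefixes = ordering , prefix-ordering

  module _ (σ : Perm q) {i} (1+i<q : suc i < q) where
    private
      a b : Fin q
      a = fromℕ< (<-trans (n<1+n i) 1+i<q)
      b = fromℕ< 1+i<q
      toℕ-a : toℕ a ≡ i
      toℕ-a = toℕ-fromℕ< _
      toℕ-b : toℕ b ≡ suc i
      toℕ-b = toℕ-fromℕ< 1+i<q

      transpose-< : ∀ {r} → r ≢ suc i → ∀ x → toℕ x < r → toℕ (transpose a b ⟨$⟩ʳ x) < r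
      transpose-< {r} r≢ x x<r with fst⊎snd⊎other a b x
      ... | inj₁ refl = subst (_< r) (sym (trans (cong toℕ (transpose-fst x b)) toℕ-b))
                          (≤∧≢⇒< (subst (_< r) toℕ-a x<r) (r≢ ∘ sym))
      ... | inj₂ (inj₁ refl) = subst (_< r) (sym (trans (cong toℕ (transpose-snd a x)) toℕ-a))
                                 (<-trans (n<1+n i) (subst (_< r) toℕ-b x<r))
      ... | inj₂ (inj₂ (x≢a , x≢b)) = subst (_< r) (sym (cong toℕ (transpose-other a b x x≢a x≢b))) x<r

    swapped : Perm q
    swapped = σ · transpose a b

    prefix-swapped : ∀ r → r ≢ suc i → prefix swapped r ≡ prefix σ r
    prefix-swapped r r≢ = ⊆-antisym
      (λ {e} e∈ → position<⇒∈prefix σ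
         (subst (λ x → toℕ x < r) (transpose-inverse a b) (transpose-< r≢ _ (∈prefix⇒position< swapped e∈))))
      (λ {e} e∈ → position<⇒∈prefix swapped
         (subst (_< r) (cong toℕ (ap (transpose-comm a b) (σ ⟨$⟩ˡ e))) (transpose-< r≢ _ (∈prefix⇒position< σ e∈))))

    position-swapped : position swapped (σ ⟨$⟩ʳ b) ≡ i
    position-swapped = trans (cong (λ x → toℕ (transpose b a ⟨$⟩ʳ x)) (inverseˡ σ))
                             (trans (cong toℕ (transpose-fst b a)) toℕ-a)

    prefix-swapped-differs : prefix swapped (suc i) ≢ prefix σ (suc i)
    prefix-swapped-differs eq = <-irrefl position-a (∈prefix⇒position< swapped (subst (σ ⟨$⟩ʳ a ∈_) (sym eq) a∈))
      where
      position-a : position swapped (σ ⟨$⟩ʳ a) ≡ suc i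
      position-a = trans (cong (λ x → toℕ (transpose b a ⟨$⟩ʳ x)) (inverseˡ σ))
                         (trans (cong toℕ (transpose-snd b a)) toℕ-b)
      a∈ : σ ⟨$⟩ʳ a ∈ prefix σ (suc i)
      a∈ = position<⇒∈prefix σ (subst (_< suc i) (sym (trans (position-⟨$⟩ʳ σ a) toℕ-a)) (n<1+n i))

    swapped-below : ∀ x → toℕ x < i → swapped ⟨$⟩ʳ x ≡ σ ⟨$⟩ʳ x
    swapped-below x x<i = cong (σ ⟨$⟩ʳ_)
      (transpose-other a b x (λ x≡a → <-irrefl (trans (cong toℕ x≡a) toℕ-a) x<i)
                             (λ x≡b → <-irrefl (trans (cong toℕ x≡b) toℕ-b) (m<n⇒m<1+n x<i)))


module PermutationEnumeration where
  open Permutations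
  open import Data.Nat using (zero; suc)
  open import Data.Fin using (Fin; zero; suc; punchOut; punchIn; combine; remQuot)
  open import Data.Fin.Properties using (_≟_; punchOut-cong; remQuot-combine; combine-remQuot)
  open import Data.Fin.Permutation using (_⟨$⟩ʳ_; insert; remove; insert-remove; remove-insert)
  open import Data.Product using (proj₁; proj₂)
  open import Data.Empty using (⊥-elim)
  open import Relation.Nullary using (yes; no)
  open import Relation.Binary.PropositionalEquality

  private
    remove-cong : ∀ {m} (i : Fin (suc m)) {π π′ : Perm (suc m)} → π ≋ π′ → remove i π ≋ remove i π′
    remove-cong i ⟪ e ⟫ = ⟪ (λ j → punchOut-cong₂ (e i) (e _)) ⟫
      where
      punchOut-cong₂ : ∀ {n} {i i′ j j′ : Fin (suc n)} {i≢j : i ≢ j} {i′≢j′ : i′ ≢ j′} →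
                       i ≡ i′ → j ≡ j′ → punchOut i≢j ≡ punchOut i′≢j′
      punchOut-cong₂ {i = i} refl refl = punchOut-cong i refl

    insert-cong : ∀ {m} (i j : Fin (suc m)) {π π′ : Perm m} → π ≋ π′ → insert i j π ≋ insert i j π′
    insert-cong i j {π} {π′} ⟪ e ⟫ = ⟪ pointwise ⟫
      where
      pointwise : ∀ k → insert i j π ⟨$⟩ʳ k ≡ insert i j π′ ⟨$⟩ʳ k
      pointwise k with i ≟ k
      ... | yes _ = refl
      ... | no _ = cong (punchIn j) (e _)

    insert-⟨$⟩ʳ : ∀ {m} (i j : Fin (suc m)) (π : Perm m) → insert i j π ⟨$⟩ʳ i ≡ j
    insert-⟨$⟩ʳ i j π with i ≟ i
    ... | yes _ = refl
    ... | no i≢i = ⊥-elim (i≢i refl)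

  -- Perm n ≅ Fin (n !), recursively splitting off the image of 0.
  enumerate : ∀ n → Fin (n !) → Perm n
  enumerate zero _ = idₚ
  enumerate (suc n) i = insert zero (proj₁ r) (enumerate n (proj₂ r))
    where r = remQuot {suc n} (n !) i

  index : ∀ n → Perm n → Fin (n !)
  index zero π = zero
  index (suc n) π = combine (π ⟨$⟩ʳ zero) (index n (remove zero π))

  index-cong : ∀ n {π π′ : Perm n} → π ≋ π′ → index n π ≡ index n π′
  index-cong zero _ = refl
  index-cong (suc n) π≋π′ = cong₂ combine (ap π≋π′ zero) (index-cong n (remove-cong zero π≋π′))

  enumerate-index : ∀ n (π : Perm n) → enumerate n (index n π) ≋ π
  enumerate-index zero π = ⟪ (λ ()) ⟫
  enumerate-index (suc n) π =
    ≋-trans (enumerate-combine (π ⟨$⟩ʳ zero) (index n (remove zero π)))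
      (≋-trans (insert-cong zero (π ⟨$⟩ʳ zero) (enumerate-index n (remove zero π))) ⟪ insert-remove zero π ⟫)
    where
    enumerate-combine : ∀ a b → enumerate (suc n) (combine a b) ≋ insert zero a (enumerate n b)
    enumerate-combine a b =
      subst (λ r → insert zero (proj₁ r) (enumerate n (proj₂ r)) ≋ insert zero a (enumerate n b))
            (sym (remQuot-combine {suc n} {n !} a b)) ≋-refl

  index-enumerate : ∀ n (i : Fin (n !)) → index n (enumerate n i) ≡ i
  index-enumerate zero zero = refl
  index-enumerate (suc n) i =
    trans (cong₂ combine (insert-⟨$⟩ʳ zero a (enumerate n b))
                         (trans (index-cong n ⟪ remove-insert zero a (enumerate n b) ⟫) (index-enumerate n b)))
          (combine-remQuot {suc n} (n !) i)
    where
    a = proj₁ (remQuot {suc n} (n !) i)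
    b = proj₂ (remQuot {suc n} (n !) i)

  enumerate-injective : ∀ n {i j : Fin (n !)} → enumerate n i ≋ enumerate n j → i ≡ j
  enumerate-injective n {i} {j} e =
    trans (sym (index-enumerate n i)) (trans (index-cong n e) (index-enumerate n j))


module EdgeSubgroups {p q : ℕ} (G : SimpleGraph p q) where
  open Permutations
  open FinSubsets
  open import Data.Nat using (zero; suc; _≤_; _<_; z≤n; s≤s)
  open import Data.Nat.Properties using (<⇒≱; <⇒≤; ≤-refl; ≤-trans; m≤n⇒m<n∨m≡n)
  open import Data.Fin using (Fin; toℕ; fromℕ<)
  open import Data.Fin.Properties using (_≟_; any?; all?; toℕ-fromℕ<; toℕ<n; toℕ-injective)
  open import Data.Fin.Permutation using (_⟨$⟩ʳ_; _⟨$⟩ˡ_; transpose; flip; inverseˡ; inverseʳ)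
  open import Data.Fin.Subset using (Subset; _∈_; _∉_; _⊆_; ∣_∣; ⁅_⁆; _∪_; ⊤; ⊥)
  open import Data.Fin.Subset.Properties
    using (⊆-antisym; _∈?_; x∈⁅x⁆; x∈⁅y⁆⇒x≡y; ∣p∣≤n; ∈⊤; ∉⊥; ∣⁅x⁆∣≡1; p⊂q⇒∣p∣<∣q∣; p⊆p∪q; q⊆p∪q; x∈p∪q⁻)
  open import Data.Product using (∃; proj₁; proj₂)
  open import Data.List using (List; []; _∷_; _++_; foldr; reverse)
  open import Data.List.Properties using (unfold-reverse)
  open import Data.List.Relation.Unary.All using (All; []; _∷_)
  open import Data.List.Relation.Unary.All.Properties using (++⁺; ∷ʳ⁺)
  open import Data.Sum using (_⊎_; inj₁; inj₂)
  open import Data.Empty using (⊥-elim)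
  open import Relation.Nullary using (¬_; Dec; yes; no)
  open import Relation.Nullary.Decidable using (_×-dec_; _⊎-dec_; ¬?)
  open import Relation.Binary.PropositionalEquality hiding (resp)
  open import Function using (_∘_)

  open SimpleGraph G public
  open Graphicahedron G public

  end₁ end₂ : Fin q → Fin p
  end₁ e = proj₁ (edge e)
  end₂ e = proj₂ (edge e)

  InT-mono : ∀ {K L t} → K ⊆ L → InT K t → InT L t
  InT-mono K⊆L (gen e e∈K) = gen e (K⊆L e∈K)
  InT-mono K⊆L one = one
  InT-mono K⊆L (mul s t) = mul (InT-mono K⊆L s) (InT-mono K⊆L t)
  InT-mono K⊆L (inv t) = inv (InT-mono K⊆L t)
  InT-mono K⊆L (resp e t) = resp e (InT-mono K⊆L t)

  InT-resp : ∀ {K σ ρ} → σ ≋ ρ → InT K σ → InT K ρ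
  InT-resp ⟪ e ⟫ t = resp e t

  InT-⊥ : ∀ {t} → InT ⊥ t → t ≋ idₚ
  InT-⊥ (gen e e∈⊥) = ⊥-elim (∉⊥ e∈⊥)
  InT-⊥ one = ≋-refl
  InT-⊥ (mul s t) = ·-cong (InT-⊥ s) (InT-⊥ t)
  InT-⊥ (inv t) = flip-cong (InT-⊥ t)
  InT-⊥ (resp e t) = ≋-trans (≋-sym ⟪ e ⟫) (InT-⊥ t)

  InT-⁅e⁆ : ∀ {t} e → InT ⁅ e ⁆ t → t ≋ idₚ ⊎ t ≋ τ e
  InT-⁅e⁆ e (gen e′ e′∈) with x∈⁅y⁆⇒x≡y e e′∈
  ... | refl = inj₂ ≋-refl
  InT-⁅e⁆ e one = inj₁ ≋-refl
  InT-⁅e⁆ e (mul s t) with InT-⁅e⁆ e s | InT-⁅e⁆ e t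
  ... | inj₁ s≋ | inj₁ t≋ = inj₁ (·-cong s≋ t≋)
  ... | inj₁ s≋ | inj₂ t≋ = inj₂ (·-cong s≋ t≋)
  ... | inj₂ s≋ | inj₁ t≋ = inj₂ (·-cong s≋ t≋)
  ... | inj₂ s≋ | inj₂ t≋ = inj₁ (≋-trans (·-cong s≋ t≋) (transpose-involutive (end₁ e) (end₂ e)))
  InT-⁅e⁆ e (inv t) with InT-⁅e⁆ e t
  ... | inj₁ t≋ = inj₁ (flip-cong t≋)
  ... | inj₂ t≋ = inj₂ (≋-trans (flip-cong t≋) (flip-transpose (end₁ e) (end₂ e)))
  InT-⁅e⁆ e (resp eq t) with InT-⁅e⁆ e t
  ... | inj₁ t≋ = inj₁ (≋-trans (≋-sym ⟪ eq ⟫) t≋)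
  ... | inj₂ t≋ = inj₂ (≋-trans (≋-sym ⟪ eq ⟫) t≋)

  τ≉id : ∀ e → ¬ (τ e ≋ idₚ)
  τ≉id e ⟪ τe≈id ⟫ = loopless e (trans (sym (τe≈id (end₁ e))) (transpose-fst (end₁ e) (end₂ e)))

  -- T_K α = T_K β, i.e. α β⁻¹ ∈ T_K
  record SameCoset (K : Subset q) (α β : Perm p) : Set where
    constructor sameCoset
    field quotient∈T : InT K (α · flip β)
  open SameCoset public

  module _ {K : Subset q} where

    SameCoset-refl : ∀ α → SameCoset K α α
    SameCoset-refl α = sameCoset (InT-resp (≋-sym (·-inverseʳ α)) one)

    ≋⇒SameCoset : ∀ {α β} → α ≋ β → SameCoset K α β
    ≋⇒SameCoset {β = β} ⟪ e ⟫ = sameCoset (resp (λ i → sym (e (β ⟨$⟩ˡ i))) (quotient∈T (SameCoset-refl β)))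

    SameCoset-sym : ∀ {α β} → SameCoset K α β → SameCoset K β α
    SameCoset-sym (sameCoset t) = sameCoset (resp (λ _ → refl) (inv t))

    SameCoset-trans : ∀ {α β γ} → SameCoset K α β → SameCoset K β γ → SameCoset K α γ
    SameCoset-trans {α} {β} (sameCoset s) (sameCoset t) =
      sameCoset (resp (λ _ → cong (α ⟨$⟩ʳ_) (inverseˡ β)) (mul s t))

    SameCoset-·ʳ : ∀ {α β} γ → SameCoset K α β → SameCoset K (α · γ) (β · γ)
    SameCoset-·ʳ {α} γ (sameCoset t) = sameCoset (resp (λ _ → cong (α ⟨$⟩ʳ_) (sym (inverseʳ γ))) t)

    SameCoset-·ʳ⁻ : ∀ {α β} γ → SameCoset K (α · γ) (β · γ) → SameCoset K α β
    SameCoset-·ʳ⁻ {α} γ (sameCoset t) = sameCoset (resp (λ _ → cong (α ⟨$⟩ʳ_) (inverseʳ γ)) t)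

  SameCoset-mono : ∀ {K L α β} → K ⊆ L → SameCoset K α β → SameCoset L α β
  SameCoset-mono K⊆L (sameCoset t) = sameCoset (InT-mono K⊆L t)

  SameCoset-⊥⇒≋ : ∀ {α β} → SameCoset ⊥ α β → α ≋ β
  SameCoset-⊥⇒≋ (sameCoset t) = ·flip≋id⇒≋ (InT-⊥ t)

  CosetIncl⇒SameCoset : ∀ {K α L β} → CosetIncl K α L β → SameCoset L α β
  CosetIncl⇒SameCoset {α = α} {β = β} incl with incl α (idₚ , one , λ _ → refl)
  ... | t , t∈T , α≈tβ = sameCoset (resp (λ i → trans (cong (t ⟨$⟩ʳ_) (sym (inverseʳ β))) (sym (α≈tβ _))) t∈T)

  SameCoset⇒CosetIncl : ∀ {K α L β} → K ⊆ L → SameCoset L α β → CosetIncl K α L β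
  SameCoset⇒CosetIncl {α = α} {β = β} K⊆L (sameCoset s) π (t , t∈T , π≈tα) =
    t · (α · flip β) , mul (InT-mono K⊆L t∈T) s ,
    λ i → trans (π≈tα i) (cong (λ z → t ⟨$⟩ʳ (α ⟨$⟩ʳ z)) (sym (inverseˡ β)))

  τ-product : List (Fin q) → Perm p
  τ-product = foldr (λ e π → τ e · π) idₚ

  τ-product-++ : ∀ xs ys → τ-product (xs ++ ys) ≋ τ-product xs · τ-product ys
  τ-product-++ [] ys = ≋-refl
  τ-product-++ (x ∷ xs) ys = ·-congʳ (τ x) (τ-product-++ xs ys)

  -- each τ e is an involution, so reversing a word inverts its product
  τ-product-reverse : ∀ xs → τ-product (reverse xs) ≋ flip (τ-product xs)
  τ-product-reverse [] = ≋-refl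
  τ-product-reverse (x ∷ xs) rewrite unfold-reverse x xs =
    ≋-trans (τ-product-++ (reverse xs) (x ∷ []))
            (·-cong (τ-product-reverse xs) (≋-sym (flip-transpose (end₁ x) (end₂ x))))

  InT⇒τ-product : ∀ {K t} → InT K t → ∃ λ ws → All (_∈ K) ws × τ-product ws ≋ t
  InT⇒τ-product (gen e e∈K) = e ∷ [] , e∈K ∷ [] , ≋-refl
  InT⇒τ-product one = [] , [] , ≋-refl
  InT⇒τ-product (mul s t) with InT⇒τ-product s | InT⇒τ-product t
  ... | xs , xs⊆K , xs≋s | ys , ys⊆K , ys≋t =
    xs ++ ys , ++⁺ xs⊆K ys⊆K , ≋-trans (τ-product-++ xs ys) (·-cong xs≋s ys≋t)
  InT⇒τ-product (inv t) with InT⇒τ-product t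
  ... | xs , xs⊆K , xs≋t = reverse xs , All-reverse xs xs⊆K , ≋-trans (τ-product-reverse xs) (flip-cong xs≋t)
    where
    All-reverse : ∀ {P : Fin q → Set} xs → All P xs → All P (reverse xs)
    All-reverse [] [] = []
    All-reverse (x ∷ xs) (px ∷ pxs) rewrite unfold-reverse x xs = ∷ʳ⁺ (All-reverse xs pxs) px
  InT⇒τ-product (resp e t) with InT⇒τ-product t
  ... | xs , xs⊆K , xs≋t = xs , xs⊆K , ≋-trans xs≋t ⟪ e ⟫

  data Path (K : Subset q) : Fin p → Fin p → Set where
    nil      : ∀ x → Path K x x
    forward  : ∀ e → e ∈ K → ∀ {y} → Path K (end₂ e) y → Path K (end₁ e) y
    backward : ∀ e → e ∈ K → ∀ {y} → Path K (end₁ e) y → Path K (end₂ e) y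

  module _ {K : Subset q} where

    path-++ : ∀ {x y z} → Path K x y → Path K y z → Path K x z
    path-++ (nil _) w = w
    path-++ (forward e e∈K v) w = forward e e∈K (path-++ v w)
    path-++ (backward e e∈K v) w = backward e e∈K (path-++ v w)

    path-reverse : ∀ {x y} → Path K x y → Path K y x
    path-reverse (nil x) = nil x
    path-reverse (forward e e∈K v) = path-++ (path-reverse v) (backward e e∈K (nil _))
    path-reverse (backward e e∈K v) = path-++ (path-reverse v) (forward e e∈K (nil _))

    -- Conjugating (b y) by the edge transposition (a b) gives (a y).
    path⇒transpose∈T : ∀ {x y} → Path K x y → InT K (transpose x y)
    path⇒transpose∈T (nil x) = InT-resp (≋-sym (transpose-self x)) one
    path⇒transpose∈T {y = y} (forward e e∈K w) with end₁ e ≟ y | end₂ e ≟ y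
    ... | yes refl | _ = InT-resp (≋-sym (transpose-self (end₁ e))) one
    ... | no _ | yes refl = gen e e∈K
    ... | no a≢y | no b≢y =
      InT-resp (transpose-conjugate (end₁ e) (end₂ e) y (loopless e) a≢y b≢y)
               (mul (gen e e∈K) (mul (path⇒transpose∈T w) (gen e e∈K)))
    path⇒transpose∈T {y = y} (backward e e∈K w) with end₂ e ≟ y | end₁ e ≟ y
    ... | yes refl | _ = InT-resp (≋-sym (transpose-self (end₂ e))) one
    ... | no _ | yes refl = InT-resp (transpose-comm (end₁ e) (end₂ e)) (gen e e∈K)
    ... | no b≢y | no a≢y =
      InT-resp (transpose-conjugate (end₂ e) (end₁ e) y (loopless e ∘ sym) b≢y a≢y)
               (mul τe′ (mul (path⇒transpose∈T w) τe′))
      where τe′ = InT-resp (transpose-comm (end₁ e) (end₂ e)) (gen e e∈K)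

    transpose-path : ∀ {x y} → Path K x y → ∀ z → Path K z (transpose x y ⟨$⟩ʳ z)
    transpose-path {x} {y} w z with fst⊎snd⊎other x y z
    ... | inj₁ refl = subst (Path K z) (sym (transpose-fst z y)) w
    ... | inj₂ (inj₁ refl) = subst (Path K z) (sym (transpose-snd x z)) (path-reverse w)
    ... | inj₂ (inj₂ (z≢x , z≢y)) = subst (Path K z) (sym (transpose-other x y z z≢x z≢y)) (nil z)

    InT⇒path : ∀ {t} → InT K t → ∀ x → Path K x (t ⟨$⟩ʳ x)
    InT⇒path (gen e e∈K) x = transpose-path (forward e e∈K (nil _)) x
    InT⇒path one x = nil x
    InT⇒path (mul {ρ = ρ} s t) x = path-++ (InT⇒path t x) (InT⇒path s (ρ ⟨$⟩ʳ x))
    InT⇒path (inv {σ} t) x =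
      path-reverse (subst (Path K (σ ⟨$⟩ˡ x)) (inverseʳ σ) (InT⇒path t (σ ⟨$⟩ˡ x)))
    InT⇒path (resp e t) x = subst (Path K x) (e x) (InT⇒path t x)

    -- Induction on k, where t fixes every point from k on: composing t with
    -- the transposition of k - 1 and its image fixes k - 1 as well.
    path⇒InT : ∀ t → (∀ x → Path K x (t ⟨$⟩ʳ x)) → InT K t
    path⇒InT t paths = fixing p ≤-refl t paths (λ x p≤x → ⊥-elim (<⇒≱ (toℕ<n x) p≤x))
      where
      fixing : ∀ k → k ≤ p → ∀ t → (∀ x → Path K x (t ⟨$⟩ʳ x)) →
               (∀ x → k ≤ toℕ x → t ⟨$⟩ʳ x ≡ x) → InT K t
      fixing zero _ t _ fixed = resp (λ x → sym (fixed x z≤n)) one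
      fixing (suc k) k<p t paths fixed =
        resp (λ y → ap (transpose-involutive x (t ⟨$⟩ʳ x)) (t ⟨$⟩ʳ y))
             (mul (path⇒transpose∈T (paths x)) (fixing k (<⇒≤ k<p) t′ paths′ fixed′))
        where
        x = fromℕ< k<p
        t′ = transpose x (t ⟨$⟩ʳ x) · t
        paths′ : ∀ y → Path K y (t′ ⟨$⟩ʳ y)
        paths′ y = path-++ (paths y) (transpose-path (paths x) (t ⟨$⟩ʳ y))
        fixed′ : ∀ y → k ≤ toℕ y → t′ ⟨$⟩ʳ y ≡ y
        fixed′ y k≤y with y ≟ x
        ... | yes refl = transpose-snd y (t ⟨$⟩ʳ y)
        ... | no y≢x = trans (cong (transpose x (t ⟨$⟩ʳ x) ⟨$⟩ʳ_) ty≡y)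
                             (transpose-other x (t ⟨$⟩ʳ x) y y≢x
                                (λ y≡tx → y≢x (⟨$⟩ʳ-injective t (trans ty≡y y≡tx))))
          where
          ty≡y : t ⟨$⟩ʳ y ≡ y
          ty≡y with m≤n⇒m<n∨m≡n k≤y
          ... | inj₁ k<y = fixed y k<y
          ... | inj₂ k≡y = ⊥-elim (y≢x (toℕ-injective (trans (sym k≡y) (sym (toℕ-fromℕ< k<p)))))

  walk⇒path : ∀ {x y} → Walk G x y → Path ⊤ x y
  walk⇒path (here x) = nil x
  walk⇒path (fwd e w) = forward e ∈⊤ (walk⇒path w)
  walk⇒path (bwd e w) = backward e ∈⊤ (walk⇒path w)

  InT-⊤ : Connected G → ∀ t → InT ⊤ t
  InT-⊤ connected t = path⇒InT t (λ x → walk⇒path (connected x (t ⟨$⟩ʳ x)))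

  SameCoset-⊤ : Connected G → ∀ α β → SameCoset ⊤ α β
  SameCoset-⊤ connected α β = sameCoset (InT-⊤ connected (α · flip β))

  -- Breadth-first search from x: reach n is the set of vertices reached
  -- after n rounds; it grows until it is closed, hence is closed at n = p.
  private module Search (K : Subset q) (x : Fin p) where

    Enters : Subset p → Fin p → Fin q → Set
    Enters S y e = e ∈ K × ((end₁ e ∈ S × end₂ e ≡ y) ⊎ (end₂ e ∈ S × end₁ e ≡ y))

    Enters? : ∀ S y e → Dec (Enters S y e)
    Enters? S y e = (e ∈? K) ×-dec (((end₁ e ∈? S) ×-dec (end₂ e ≟ y)) ⊎-dec ((end₂ e ∈? S) ×-dec (end₁ e ≟ y)))

    expand : Subset p → Subset p
    expand S = S ∪ satisfying (λ y → any? (Enters? S y))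

    reach : ℕ → Subset p
    reach zero = ⁅ x ⁆
    reach (suc n) = expand (reach n)

    reach-step : ∀ n → reach n ⊆ reach (suc n)
    reach-step n = p⊆p∪q _

    x∈reach : ∀ n → x ∈ reach n
    x∈reach zero = x∈⁅x⁆ x
    x∈reach (suc n) = reach-step n (x∈reach n)

    reach⇒path : ∀ n {y} → y ∈ reach n → Path K x y
    reach⇒path zero y∈ with x∈⁅y⁆⇒x≡y x y∈
    ... | refl = nil x
    reach⇒path (suc n) {y} y∈ with x∈p∪q⁻ (reach n) _ y∈
    ... | inj₁ y∈′ = reach⇒path n y∈′
    ... | inj₂ y∈new with ∈satisfying⁻ (λ y → any? (Enters? (reach n) y)) y∈new
    ...   | e , e∈K , inj₁ (a∈ , refl) = path-++ (reach⇒path n a∈) (forward e e∈K (nil _))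
    ...   | e , e∈K , inj₂ (b∈ , refl) = path-++ (reach⇒path n b∈) (backward e e∈K (nil _))

    Closed : Subset p → Set
    Closed S = ∀ e → e ∈ K → (end₁ e ∈ S → end₂ e ∈ S) × (end₂ e ∈ S → end₁ e ∈ S)

    Closed⇒path-stays : ∀ {S x′ y} → Closed S → x′ ∈ S → Path K x′ y → y ∈ S
    Closed⇒path-stays closed x′∈ (nil _) = x′∈
    Closed⇒path-stays closed a∈ (forward e e∈K w) = Closed⇒path-stays closed (proj₁ (closed e e∈K) a∈) w
    Closed⇒path-stays closed b∈ (backward e e∈K w) = Closed⇒path-stays closed (proj₂ (closed e e∈K) b∈) w

    Leaves : Subset p → Fin q → Set
    Leaves S e = e ∈ K × ((end₁ e ∈ S × end₂ e ∉ S) ⊎ (end₂ e ∈ S × end₁ e ∉ S))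

    closed⊎leaves : ∀ S → Closed S ⊎ ∃ (Leaves S)
    closed⊎leaves S with any? (λ e → (e ∈? K) ×-dec (((end₁ e ∈? S) ×-dec ¬? (end₂ e ∈? S))
                                                    ⊎-dec ((end₂ e ∈? S) ×-dec ¬? (end₁ e ∈? S))))
    ... | yes leaving = inj₂ leaving
    ... | no none = inj₁ λ e e∈K → (λ a∈ → stable (end₂ e ∈? S) (λ b∉ → none (e , e∈K , inj₁ (a∈ , b∉))))
                                   , (λ b∈ → stable (end₁ e ∈? S) (λ a∉ → none (e , e∈K , inj₂ (b∈ , a∉))))
      where
      stable : ∀ {A : Set} → Dec A → ¬ ¬ A → A
      stable (yes a) _ = a
      stable (no ¬a) ¬¬a = ⊥-elim (¬¬a ¬a)

    expand-closed : ∀ {S} → Closed S → expand S ≡ S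
    expand-closed {S} closed = ⊆-antisym shrinks (p⊆p∪q _)
      where
      shrinks : expand S ⊆ S
      shrinks {y} y∈ with x∈p∪q⁻ S _ y∈
      ... | inj₁ y∈S = y∈S
      ... | inj₂ y∈new with ∈satisfying⁻ (λ y → any? (Enters? S y)) y∈new
      ...   | e , e∈K , inj₁ (a∈ , refl) = proj₁ (closed e e∈K) a∈
      ...   | e , e∈K , inj₂ (b∈ , refl) = proj₂ (closed e e∈K) b∈

    Closed-expand : ∀ {S} → Closed S → Closed (expand S)
    Closed-expand closed = subst Closed (sym (expand-closed closed)) closed

    expand-leaves : ∀ S → ∃ (Leaves S) → ∣ S ∣ < ∣ expand S ∣
    expand-leaves S (e , e∈K , inj₁ (a∈ , b∉)) = p⊂q⇒∣p∣<∣q∣ (p⊆p∪q _ , end₂ e , new , b∉)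
      where new = q⊆p∪q S _ (∈satisfying⁺ (λ y → any? (Enters? S y)) (e , e∈K , inj₁ (a∈ , refl)))
    expand-leaves S (e , e∈K , inj₂ (b∈ , a∉)) = p⊂q⇒∣p∣<∣q∣ (p⊆p∪q _ , end₁ e , new , a∉)
      where new = q⊆p∪q S _ (∈satisfying⁺ (λ y → any? (Enters? S y)) (e , e∈K , inj₂ (b∈ , refl)))

    grows⊎closed : ∀ n → suc n ≤ ∣ reach n ∣ ⊎ Closed (reach n)
    grows⊎closed zero = inj₁ (subst (1 ≤_) (sym (∣⁅x⁆∣≡1 x)) ≤-refl)
    grows⊎closed (suc n) with grows⊎closed n | closed⊎leaves (reach n)
    ... | inj₁ grows  | inj₂ leaving = inj₁ (≤-trans (s≤s grows) (expand-leaves (reach n) leaving))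
    ... | _           | inj₁ closed  = inj₂ (Closed-expand closed)
    ... | inj₂ closed | inj₂ _       = inj₂ (Closed-expand closed)

    reach-closed : Closed (reach p)
    reach-closed with grows⊎closed p
    ... | inj₁ too-big = ⊥-elim (<⇒≱ too-big (∣p∣≤n (reach p)))
    ... | inj₂ closed = closed

    Path? : ∀ y → Dec (Path K x y)
    Path? y with y ∈? reach p
    ... | yes y∈ = yes (reach⇒path p y∈)
    ... | no y∉ = no (λ w → y∉ (Closed⇒path-stays reach-closed (x∈reach p) w))

  InT? : ∀ K t → Dec (InT K t)
  InT? K t with all? (λ x → Search.Path? K x (t ⟨$⟩ʳ x))
  ... | yes paths = yes (path⇒InT t paths)
  ... | no ¬paths = no (λ t∈T → ¬paths (InT⇒path t∈T))

  SameCoset? : ∀ K α β → Dec (SameCoset K α β)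
  SameCoset? K α β with InT? K (α · flip β)
  ... | yes t∈T = yes (sameCoset t∈T)
  ... | no t∉T = no (λ s → t∉T (quotient∈T s))


module ChainsOfPosets {F : Set} {_≈_ _≤_ : Rel F 0ℓ} (isPO : IsPartialOrder _≈_ _≤_) (rank : F → ℤ) where
  open import Data.Nat using (zero; suc; _<_; z<s; s<s)
  open import Data.List using (List; []; _∷_; _++_; applyUpTo)
  open import Data.List.Relation.Unary.Any using (here; there)
  open import Data.List.Relation.Unary.All using (All; []; _∷_)
  import Data.List.Relation.Unary.All as All
  open import Data.List.Relation.Unary.All.Properties using (++⁺)
  open import Data.List.Relation.Unary.Linked using (Linked; [-]; _∷_)
  import Data.List.Relation.Unary.Linked as Linked
  open import Data.List.Relation.Binary.Pointwise using (Pointwise; []; _∷_; Any-resp-Pointwise)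
  import Data.List.Relation.Binary.Pointwise as Pointwise
  open import Data.Product using (∃; proj₁; proj₂)
  open import Data.Sum using (inj₁; inj₂)
  open import Data.Empty using (⊥; ⊥-elim)
  open import Function using (_∘_)
  open import Relation.Binary.Structures using (IsEquivalence)
  open import Relation.Binary.PropositionalEquality using (_≡_; refl)

  open PolytopeNotions _≈_ _≤_ rank public
  open IsPartialOrder isPO using (isEquivalence; reflexive; antisym) renaming (trans to ≤-trans)
  open IsEquivalence isEquivalence using () renaming (refl to ≈-refl; sym to ≈-sym; trans to ≈-trans)
  open IsEquivalence (Pointwise.isEquivalence isEquivalence) public
    using () renaming (sym to Pointwise-sym; trans to Pointwise-trans)

  private variable
    x y z w : F
    A B L post : List F

  <F-trans : x <F y → y <F z → x <F z
  <F-trans (x≤y , _) (y≤z , y≉z) =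
    ≤-trans x≤y y≤z , λ x≈z → y≉z (antisym y≤z (≤-trans (reflexive (≈-sym x≈z)) x≤y))

  <F-respʳ : y ≈ z → x <F y → x <F z
  <F-respʳ y≈z (x≤y , x≉y) = ≤-trans x≤y (reflexive y≈z) , λ x≈z → x≉y (≈-trans x≈z (≈-sym y≈z))

  <F-asym : x <F y → y <F x → ⊥
  <F-asym (x≤y , x≉y) (y≤x , _) = x≉y (antisym x≤y y≤x)

  ∈L-resp : x ≈ y → x ∈L L → y ∈L L
  ∈L-resp x≈y (here x≈z) = here (≈-trans (≈-sym x≈y) x≈z)
  ∈L-resp x≈y (there x∈) = there (∈L-resp x≈y x∈)

  ∈L-Pointwise : Pointwise _≈_ A B → x ∈L A → x ∈L B
  ∈L-Pointwise = Any-resp-Pointwise (λ y≈z x≈y → ≈-trans x≈y y≈z)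

  head<F : IsChain (x ∷ L) → y ∈L L → x <F y
  head<F (x<z ∷ _) (here y≈z) = <F-respʳ (≈-sym y≈z) x<z
  head<F (x<z ∷ chain) (there y∈) = <F-trans x<z (head<F chain y∈)

  chain⇒comparable : IsChain L → x ∈L L → y ∈L L → Comparable x y
  chain⇒comparable _ (here x≈z) (here y≈z) = inj₁ (reflexive (≈-trans x≈z (≈-sym y≈z)))
  chain⇒comparable chain (here x≈z) (there y∈) = inj₁ (≤-trans (reflexive x≈z) (proj₁ (head<F chain y∈)))
  chain⇒comparable chain (there x∈) (here y≈z) = inj₂ (≤-trans (reflexive y≈z) (proj₁ (head<F chain x∈)))
  chain⇒comparable chain (there x∈) (there y∈) = chain⇒comparable (Linked.tail chain) x∈ y∈

  ∈L-split : x ∈L L → ∃ λ pre → ∃ λ w → ∃ λ post → L ≡ pre ++ w ∷ post × x ≈ w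
  ∈L-split {L = w ∷ L} (here x≈w) = [] , w , L , refl , x≈w
  ∈L-split {L = y ∷ L} (there x∈) with ∈L-split x∈
  ... | pre , w , post , refl , x≈w = y ∷ pre , w , post , refl , x≈w

  adjacent<F : ∀ pre → IsChain (pre ++ w ∷ y ∷ post) → w <F y
  adjacent<F [] (w<y ∷ _) = w<y
  adjacent<F (_ ∷ []) (_ ∷ chain) = adjacent<F [] chain
  adjacent<F (_ ∷ x′ ∷ pre) (_ ∷ chain) = adjacent<F (x′ ∷ pre) chain

  comparable-inserted : ∀ pre → IsChain (pre ++ w ∷ post) → w ≤ z →
                        (∀ {y post′} → post ≡ y ∷ post′ → z ≤ y) → All (Comparable z) (pre ++ w ∷ post)
  comparable-inserted {w} {post} {z} pre chain w≤z z≤next =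
    ++⁺ (All.map (λ x≤w → inj₂ (≤-trans x≤w w≤z)) (before pre chain))
        (inj₂ w≤z ∷ after post (from-w pre chain) z≤next)
    where
    w∈ : ∀ pre → w ∈L (pre ++ w ∷ post)
    w∈ [] = here ≈-refl
    w∈ (_ ∷ pre) = there (w∈ pre)
    before : ∀ pre → IsChain (pre ++ w ∷ post) → All (_≤ w) pre
    before [] _ = []
    before (_ ∷ pre) chain = proj₁ (head<F chain (w∈ pre)) ∷ before pre (Linked.tail chain)
    from-w : ∀ pre → IsChain (pre ++ w ∷ post) → IsChain (w ∷ post)
    from-w [] chain = chain
    from-w (_ ∷ pre) chain = from-w pre (Linked.tail chain)
    above : ∀ {y L} → IsChain (y ∷ L) → All (y ≤_) L
    above [-] = []
    above (y<y′ ∷ chain) = proj₁ y<y′ ∷ All.map (≤-trans (proj₁ y<y′)) (above chain)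
    after : ∀ post → IsChain (w ∷ post) → (∀ {y post′} → post ≡ y ∷ post′ → z ≤ y) → All (Comparable z) post
    after [] _ _ = []
    after (y ∷ post) chain z≤y = inj₁ (z≤y refl) ∷ All.map (inj₁ ∘ ≤-trans (z≤y refl)) (above (Linked.tail chain))

  sameMembers⇒Pointwise : IsChain A → IsChain B → (∀ x → x ∈L A → x ∈L B) → (∀ x → x ∈L B → x ∈L A) →
                          Pointwise _≈_ A B
  sameMembers⇒Pointwise {[]} {[]} _ _ _ _ = []
  sameMembers⇒Pointwise {[]} {b ∷ B} _ _ _ B⊆A with B⊆A b (here ≈-refl)
  ... | ()
  sameMembers⇒Pointwise {a ∷ A} {[]} _ _ A⊆B _ with A⊆B a (here ≈-refl)
  ... | ()
  sameMembers⇒Pointwise {a ∷ A} {b ∷ B} chainA chainB A⊆B B⊆A =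
    a≈b ∷ sameMembers⇒Pointwise (Linked.tail chainA) (Linked.tail chainB) A⊆B′ B⊆A′
    where
    a≈b : a ≈ b
    a≈b with A⊆B a (here ≈-refl) | B⊆A b (here ≈-refl)
    ... | here a≈b | _ = a≈b
    ... | there _ | here b≈a = ≈-sym b≈a
    ... | there a∈B | there b∈A = ⊥-elim (<F-asym (head<F chainB a∈B) (head<F chainA b∈A))
    A⊆B′ : ∀ x → x ∈L A → x ∈L B
    A⊆B′ x x∈A with A⊆B x (there x∈A)
    ... | here x≈b = ⊥-elim (proj₂ (head<F chainA x∈A) (≈-trans a≈b (≈-sym x≈b)))
    ... | there x∈B = x∈B
    B⊆A′ : ∀ x → x ∈L B → x ∈L A
    B⊆A′ x x∈B with B⊆A x (there x∈B)
    ... | here x≈a = ⊥-elim (proj₂ (head<F chainB x∈B) (≈-trans (≈-sym a≈b) (≈-sym x≈a)))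
    ... | there x∈A = x∈A

  FlagSeq-Pointwise : ∀ {Φ Φ′ Ψ Ψ′} → Pointwise _≈_ Φ Φ′ → Pointwise _≈_ Ψ Ψ′ →
                      FlagSeq Φ Ψ Φ → FlagSeq Φ′ Ψ′ Φ′
  FlagSeq-Pointwise {Φ} {Φ′} {Ψ} {Ψ′} Φ≈ Ψ≈ (done Φ≈Ψ) =
    done (Pointwise-trans (Pointwise-sym Φ≈) (Pointwise-trans Φ≈Ψ Ψ≈))
  FlagSeq-Pointwise {Φ} {Φ′} {Ψ} {Ψ′} Φ≈ Ψ≈ (step flag differ meet rest) =
    step flag (differ-start differ) (meet-transport meet) (transport rest)
    where
    back : ∀ {x A A′} → Pointwise _≈_ A A′ → x ∈L A′ → x ∈L A
    back A≈ = ∈L-Pointwise (Pointwise-sym A≈)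
    meet-transport : ∀ {Λ} → ContainsMeet Φ Ψ Λ → ContainsMeet Φ′ Ψ′ Λ
    meet-transport meet x x∈Φ′ x∈Ψ′ = meet x (back Φ≈ x∈Φ′) (back Ψ≈ x∈Ψ′)
    transport : ∀ {Λ} → FlagSeq Φ Ψ Λ → FlagSeq Φ′ Ψ′ Λ
    transport (done Λ≈Ψ) = done (Pointwise-trans Λ≈Ψ Ψ≈)
    transport (step flag differ meet rest) = step flag differ (meet-transport meet) (transport rest)
    differ-start : ∀ {Λ} → DifferInOne Φ Λ → DifferInOne Φ′ Λ
    differ-start ((a , a∈ , a∉ , a-unique) , (b , b∈ , b∉ , b-unique)) =
      (a , ∈L-Pointwise Φ≈ a∈ , a∉ , λ x x∈ x∉ → a-unique x (back Φ≈ x∈) x∉) ,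
      (b , b∈ , (b∉ ∘ back Φ≈) , λ x x∈ x∉ → b-unique x x∈ (x∉ ∘ ∈L-Pointwise Φ≈))

  applyUpTo-Pointwise⁺ : ∀ f g n → (∀ {i} → i < n → f i ≈ g i) →
                         Pointwise _≈_ (applyUpTo f n) (applyUpTo g n)
  applyUpTo-Pointwise⁺ f g zero _ = []
  applyUpTo-Pointwise⁺ f g (suc n) f≈g = f≈g z<s ∷ applyUpTo-Pointwise⁺ (f ∘ suc) (g ∘ suc) n (f≈g ∘ s<s)

  applyUpTo-Pointwise⁻ : ∀ f g n → Pointwise _≈_ (applyUpTo f n) (applyUpTo g n) →
                         ∀ {i} → i < n → f i ≈ g i
  applyUpTo-Pointwise⁻ f g (suc n) (f0≈g0 ∷ _) z<s = f0≈g0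
  applyUpTo-Pointwise⁻ f g (suc n) (_ ∷ rest) {suc i} (s<s i<n) =
    applyUpTo-Pointwise⁻ (f ∘ suc) (g ∘ suc) n rest i<n


module GraphicahedronOrder {p q : ℕ} (G : SimpleGraph p q) where
  open Permutations
  open FinSubsets
  open PrefixSubsets
  open EdgeSubgroups G
  open import Data.Nat using (suc; _+_; _≤_; _<_; s≤s; s<s)
  open import Data.Nat.Properties using (<-irrefl; +-comm; m≤n⇒m<n∨m≡n; n<1+n; n≤1+n; <⇒≤)
  open import Data.Integer as ℤ using () renaming (_<_ to _<ℤ_)
  open import Data.Fin.Subset using (_⊆_; ∣_∣)
  open import Data.Fin.Subset.Properties using (⊆-antisym; ⊆-refl; ⊆-trans; p⊆q⇒∣p∣≤∣q∣; ∣p∣≤n)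
  open import Data.List using (List; _∷_; applyUpTo; length)
  open import Data.List.Properties using (length-applyUpTo)
  open import Data.List.Relation.Unary.Any using (here; there)
  import Data.List.Relation.Unary.Any.Properties as Any
  open import Data.List.Relation.Unary.All using (_∷_)
  import Data.List.Relation.Unary.All.Properties as All
  open import Data.List.Relation.Unary.Linked using (_∷_)
  import Data.List.Relation.Unary.Linked.Properties as Linked
  open import Data.List.Relation.Binary.Pointwise using (Pointwise; _∷_)
  open import Data.Unit using (tt)
  open import Data.Product using (∃; proj₁)
  open import Data.Sum using (inj₁; inj₂)
  open import Data.Empty using (⊥-elim)
  open import Relation.Binary.PropositionalEquality hiding (resp)
  open import Function using (_∘′_)
  open import Data.List.Relation.Unary.All using (All)

  face≈face⁺ : ∀ {K L α β} → K ≡ L → SameCoset K α β → face K α ≈F face L β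
  face≈face⁺ refl s = refl , SameCoset⇒CosetIncl ⊆-refl s , SameCoset⇒CosetIncl ⊆-refl (SameCoset-sym s)

  face≈face⁻ : ∀ {K L} α β → face K α ≈F face L β → K ≡ L × SameCoset K α β
  face≈face⁻ _ _ (refl , incl , _) = refl , CosetIncl⇒SameCoset incl

  face≤face⁺ : ∀ {K L α β} → K ⊆ L → SameCoset L α β → face K α ≤F face L β
  face≤face⁺ K⊆L s = K⊆L , SameCoset⇒CosetIncl K⊆L s

  face≤face⁻ : ∀ {K L} α β → face K α ≤F face L β → K ⊆ L × SameCoset L α β
  face≤face⁻ _ _ (K⊆L , incl) = K⊆L , CosetIncl⇒SameCoset incl

  ≈F-refl : ∀ {x} → x ≈F x
  ≈F-refl {bot} = tt
  ≈F-refl {face K α} = face≈face⁺ refl (SameCoset-refl α)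

  ≈F-sym : ∀ {x y} → x ≈F y → y ≈F x
  ≈F-sym {bot} {bot} _ = tt
  ≈F-sym {face _ α} {face _ β} x≈y with face≈face⁻ α β x≈y
  ... | refl , s = face≈face⁺ refl (SameCoset-sym s)

  ≈F-trans : ∀ {x y z} → x ≈F y → y ≈F z → x ≈F z
  ≈F-trans {bot} {bot} {bot} _ _ = tt
  ≈F-trans {face _ α} {face _ β} {face _ γ} x≈y y≈z with face≈face⁻ α β x≈y | face≈face⁻ β γ y≈z
  ... | refl , s | refl , t = face≈face⁺ refl (SameCoset-trans s t)

  ≤F-reflexive : ∀ {x y} → x ≈F y → x ≤F y
  ≤F-reflexive {bot} _ = tt
  ≤F-reflexive {face _ α} {face _ β} x≈y with face≈face⁻ α β x≈y
  ... | refl , s = face≤face⁺ ⊆-refl s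

  ≤F-trans : ∀ {x y z} → x ≤F y → y ≤F z → x ≤F z
  ≤F-trans {bot} _ _ = tt
  ≤F-trans {face _ α} {face _ β} {face _ γ} x≤y y≤z with face≤face⁻ α β x≤y | face≤face⁻ β γ y≤z
  ... | K⊆L , s | L⊆M , t = face≤face⁺ (⊆-trans K⊆L L⊆M) (SameCoset-trans (SameCoset-mono L⊆M s) t)

  ≤F-antisym : ∀ {x y} → x ≤F y → y ≤F x → x ≈F y
  ≤F-antisym {bot} {bot} _ _ = tt
  ≤F-antisym {face _ α} {face _ β} x≤y y≤x with face≤face⁻ α β x≤y | face≤face⁻ β α y≤x
  ... | K⊆L , s | L⊆K , _ with ⊆-antisym K⊆L L⊆K
  ... | refl = face≈face⁺ refl s

  ≤F-isPartialOrder : IsPartialOrder _≈F_ _≤F_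
  ≤F-isPartialOrder = record
    { isPreorder = record
      { isEquivalence = record { refl = ≈F-refl ; sym = ≈F-sym ; trans = ≈F-trans }
      ; reflexive = ≤F-reflexive
      ; trans = ≤F-trans }
    ; antisym = ≤F-antisym }

  open ChainsOfPosets ≤F-isPartialOrder rankF public

  -- rank + 1, which avoids working in ℤ
  height : Face → ℕ
  height bot = 0
  height (face K _) = suc ∣ K ∣

  height-resp : ∀ {x y} → x ≈F y → height x ≡ height y
  height-resp {bot} {bot} _ = refl
  height-resp {face _ _} {face _ _} (K≡L , _) = cong (suc ∘′ ∣_∣) K≡L

  face<face⇒∣∣<∣∣ : ∀ {K L} α β → face K α <F face L β → ∣ K ∣ < ∣ L ∣
  face<face⇒∣∣<∣∣ α β (K≤L , K≉L) with face≤face⁻ α β K≤L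
  ... | K⊆L , s with m≤n⇒m<n∨m≡n (p⊆q⇒∣p∣≤∣q∣ K⊆L)
  ... | inj₁ lt = lt
  ... | inj₂ eq with p⊆q⇒∣p∣≡∣q∣⇒p≡q K⊆L eq
  ... | refl = ⊥-elim (K≉L (face≈face⁺ refl s))

  <F⇒rank< : ∀ x y → x <F y → rankF x <ℤ rankF y
  <F⇒rank< bot bot (_ , x≉y) = ⊥-elim (x≉y tt)
  <F⇒rank< bot (face _ _) _ = ℤ.-<+
  <F⇒rank< (face _ α) (face _ β) x<y = ℤ.+<+ (face<face⇒∣∣<∣∣ α β x<y)

  comparable⇒∣∣≡⇒≈F : ∀ {K L} α β → Comparable (face K α) (face L β) → ∣ K ∣ ≡ ∣ L ∣ →
                      face K α ≈F face L β
  comparable⇒∣∣≡⇒≈F α β (inj₁ K≤L) eq with face≤face⁻ α β K≤L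
  ... | K⊆L , s with p⊆q⇒∣p∣≡∣q∣⇒p≡q K⊆L eq
  ... | refl = face≈face⁺ refl s
  comparable⇒∣∣≡⇒≈F α β (inj₂ L≤K) eq with face≤face⁻ β α L≤K
  ... | L⊆K , s with p⊆q⇒∣p∣≡∣q∣⇒p≡q L⊆K (sym eq)
  ... | refl = face≈face⁺ refl (SameCoset-sym s)

  flagFace : Perm p → Perm q → ℕ → Face
  flagFace α σ i = face (prefix σ i) α

  flag : Perm p → Perm q → List Face
  flag α σ = bot ∷ applyUpTo (flagFace α σ) (suc q)

  height-flagFace : ∀ α σ {i} → i ≤ q → height (flagFace α σ i) ≡ suc i
  height-flagFace α σ i≤q = cong suc (∣prefix∣≡ σ _ i≤q)

  flag-isChain : ∀ α σ → IsChain (flag α σ)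
  flag-isChain α σ = (tt , λ ()) ∷ Linked.applyUpTo⁺₁ (flagFace α σ) (suc q) increasing
    where
    increasing : ∀ {i} → suc i < suc q → flagFace α σ i <F flagFace α σ (suc i)
    increasing {i} (s<s i<q) = face≤face⁺ (prefix-mono σ (n≤1+n i)) (SameCoset-refl α) ,
      λ i≈1+i → <-irrefl (trans (sym (∣prefix∣≡ σ i (<⇒≤ i<q)))
                           (trans (cong ∣_∣ (proj₁ i≈1+i)) (∣prefix∣≡ σ (suc i) i<q))) (n<1+n i)

  flagFace∈flag : ∀ α σ {i} → i ≤ q → flagFace α σ i ∈L flag α σ
  flagFace∈flag α σ {i} i≤q = there (Any.applyUpTo⁺ (flagFace α σ) (≈F-refl {flagFace α σ i}) (s≤s i≤q))

  ∈flag⁻ : ∀ α σ {x} → x ∈L applyUpTo (flagFace α σ) (suc q) → ∃ λ i → i ≤ q × x ≈F flagFace α σ i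
  ∈flag⁻ α σ x∈ with Any.applyUpTo⁻ (flagFace α σ) x∈
  ... | i , s≤s i≤q , x≈ = i , i≤q , x≈

  flag-maximal : ∀ α σ g → All (Comparable g) (flag α σ) → g ∈L flag α σ
  flag-maximal α σ bot _ = here tt
  flag-maximal α σ (face K γ) (_ ∷ comparable) =
    ∈L-resp (≈F-sym {face K γ} {flagFace α σ ∣ K ∣}
               (comparable⇒∣∣≡⇒≈F γ α comparableₖ (sym (∣prefix∣≡ σ ∣ K ∣ (∣p∣≤n K)))))
            (flagFace∈flag α σ (∣p∣≤n K))
    where
    comparableₖ : Comparable (face K γ) (flagFace α σ ∣ K ∣)
    comparableₖ = All.applyUpTo⁻ (flagFace α σ) (suc q) comparable (s≤s (∣p∣≤n K))

  flag-isFlag : ∀ α σ → IsFlag (flag α σ)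
  flag-isFlag α σ = flag-isChain α σ , flag-maximal α σ

  flag-cong : ∀ {α α′ σ σ′} → α ≋ α′ → σ ≋ σ′ → Pointwise _≈F_ (flag α σ) (flag α′ σ′)
  flag-cong {α} {α′} {σ} {σ′} α≋α′ σ≋σ′ = tt ∷ applyUpTo-Pointwise⁺ (flagFace α σ) (flagFace α′ σ′) (suc q)
    (λ {i} _ → face≈face⁺ (prefix-cong σ≋σ′ i) (≋⇒SameCoset α≋α′))

  length-flag : ∀ α σ → length (flag α σ) ≡ q + 2
  length-flag α σ = trans (cong suc (length-applyUpTo (flagFace α σ) (suc q))) (+-comm 2 q)


module FlagClassification {p q : ℕ} (G : SimpleGraph p q) where
  open Permutations
  open FinSubsets
  open PrefixSubsets
  open EdgeSubgroups G
  open GraphicahedronOrder G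
  open import Data.Nat using (zero; suc; _≤_; _<_; _⊓_; z≤n; s≤s)
  open import Data.Nat.Properties
    using (<⇒≤; n≤1+n; suc-injective; ≤-antisym; m⊓n≤n; ⊓-monoˡ-≤; m≤n⇒m⊓n≡m)
  open import Data.Fin.Subset using (Subset; _⊆_; ∣_∣; ⁅_⁆; _∪_; ⊤; ⊥)
  open import Data.Fin.Subset.Properties using (⊆⊤; ⊥⊆; ∣⊥∣≡0; ∣⊤∣≡n; p⊆p∪q; p⊆q⇒∣p∣≤∣q∣)
  open import Data.List using (List; []; _∷_)
  open import Data.List.Relation.Unary.Any using (here; there)
  import Data.List.Relation.Unary.Any as Any
  open import Data.List.Relation.Unary.All using (All; []; _∷_)
  import Data.List.Relation.Unary.All as All
  open import Data.List.Relation.Binary.Pointwise using (Pointwise; _∷_)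
  open import Data.Unit using (tt)
  open import Data.Product using (∃; ∃₂; proj₁; proj₂)
  open import Data.Sum using (inj₁; inj₂)
  open import Data.Empty using (⊥-elim)
  open import Relation.Binary.PropositionalEquality hiding (resp)

  cover-above : ∀ w → height w ≤ q → ∃ λ z → w ≤F z × height z ≡ suc (height w)
  cover-above bot _ = face ⊥ idₚ , tt , cong suc (∣⊥∣≡0 q)
  cover-above (face K γ) ∣K∣<q with p⊆q⇒∣p∣<∣q∣⇒p⊂q {q = ⊤} ⊆⊤ (subst (∣ K ∣ <_) (sym (∣⊤∣≡n q)) ∣K∣<q)
  ... | _ , e , _ , e∉K =
    face (K ∪ ⁅ e ⁆) γ , face≤face⁺ (p⊆p∪q _) (SameCoset-refl γ) , cong suc (x∉p⇒∣p∪⁅x⁆∣≡1+∣p∣ K e∉K)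

  cover-between : ∀ w y → w <F y → ∃ λ z → w ≤F z × z ≤F y × height z ≡ suc (height w)
  cover-between bot bot (_ , w≉y) = ⊥-elim (w≉y tt)
  cover-between bot (face L δ) _ = face ⊥ δ , tt , face≤face⁺ ⊥⊆ (SameCoset-refl δ) , cong suc (∣⊥∣≡0 q)
  cover-between (face K γ) (face L δ) w<y with face≤face⁻ γ δ (proj₁ w<y)
  ... | K⊆L , s with p⊆q⇒∣p∣<∣q∣⇒p⊂q K⊆L (face<face⇒∣∣<∣∣ γ δ w<y)
  ... | _ , e , e∈L , e∉K =
    face (K ∪ ⁅ e ⁆) γ , face≤face⁺ (p⊆p∪q _) (SameCoset-refl γ) , face≤face⁺ (p⊆r⇒y∈r⇒p∪⁅y⁆⊆r K⊆L e∈L) s ,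
    cong suc (x∉p⇒∣p∪⁅x⁆∣≡1+∣p∣ K e∉K)

  -- A flag Φ has a face of every rank r ≤ q; the faces of Φ give a full
  -- chain of edge sets, i.e. an ordering σ of the edges, and Φ is the
  -- flag of (α, σ) where α is its vertex.
  module Canonical (Φ : List Face) (Φ-isFlag : IsFlag Φ) where
    chain = proj₁ Φ-isFlag
    maximal = proj₂ Φ-isFlag

    bot∈Φ : bot ∈L Φ
    bot∈Φ = maximal bot (All.universal (λ _ → inj₁ tt) Φ)

    successor∈Φ : ∀ w → w ∈L Φ → height w ≤ q → ∃ λ z → z ∈L Φ × height z ≡ suc (height w)
    successor∈Φ w w∈Φ height≤q with ∈L-split w∈Φ
    ... | pre , w′ , post , refl , w≈w′ = after post refl
      where
      same = height-resp {w} {w′} w≈w′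
      after : ∀ post′ → post ≡ post′ → ∃ λ z → z ∈L Φ × height z ≡ suc (height w)
      after [] refl with cover-above w′ (subst (_≤ q) same height≤q)
      ... | z , w′≤z , height-z =
        z , maximal z (comparable-inserted pre chain w′≤z (λ ())) , trans height-z (cong suc (sym same))
      after (y ∷ post′) refl with cover-between w′ y (adjacent<F pre chain)
      ... | z , w′≤z , z≤y , height-z =
        z , maximal z (comparable-inserted pre chain w′≤z λ { refl → z≤y }) , trans height-z (cong suc (sym same))

    record FaceOfRank (r : ℕ) : Set where
      field
        edges : Subset q
        vertex : Perm p
        ∈Φ : face edges vertex ∈L Φ
        ∣edges∣≡ : ∣ edges ∣ ≡ r

    faceOfRank : ∀ r → r ≤ q → FaceOfRank r
    faceOfRank zero _ with successor∈Φ bot bot∈Φ z≤n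
    ... | face K γ , ∈Φ , height≡ = record { edges = K ; vertex = γ ; ∈Φ = ∈Φ ; ∣edges∣≡ = suc-injective height≡ }
    faceOfRank (suc r) r<q with faceOfRank r (<⇒≤ r<q)
    ... | record { edges = K ; vertex = γ ; ∈Φ = K∈Φ ; ∣edges∣≡ = refl }
      with successor∈Φ (face K γ) K∈Φ r<q
    ... | face L δ , ∈Φ , height≡ = record { edges = L ; vertex = δ ; ∈Φ = ∈Φ ; ∣edges∣≡ = suc-injective height≡ }

    -- ranks beyond q are clamped, to get a chain indexed by all of ℕ
    clamped : ∀ r → FaceOfRank (r ⊓ q)
    clamped r = faceOfRank (r ⊓ q) (m⊓n≤n r q)

    K : ℕ → Subset q
    K r = FaceOfRank.edges (clamped r)

    γ : ℕ → Perm p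
    γ r = FaceOfRank.vertex (clamped r)

    K∈Φ : ∀ r → face (K r) (γ r) ∈L Φ
    K∈Φ r = FaceOfRank.∈Φ (clamped r)

    ∣K∣≡ : ∀ r → r ≤ q → ∣ K r ∣ ≡ r
    ∣K∣≡ r r≤q = trans (FaceOfRank.∣edges∣≡ (clamped r)) (m≤n⇒m⊓n≡m r≤q)

    K-mono : ∀ i j → i ≤ j → face (K i) (γ i) ≤F face (K j) (γ j)
    K-mono i j i≤j with chain⇒comparable chain (K∈Φ i) (K∈Φ j)
    ... | inj₁ i≤Fj = i≤Fj
    ... | inj₂ j≤Fi =
      ≤F-reflexive {face (K i) (γ i)} {face (K j) (γ j)}
        (≈F-sym {face (K j) (γ j)} {face (K i) (γ i)} (comparable⇒∣∣≡⇒≈F (γ j) (γ i) (inj₁ j≤Fi) ∣Kj∣≡∣Ki∣))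
      where
      ∣Kj∣≡∣Ki∣ : ∣ K j ∣ ≡ ∣ K i ∣
      ∣Kj∣≡∣Ki∣ = ≤-antisym (p⊆q⇒∣p∣≤∣q∣ (proj₁ (face≤face⁻ (γ j) (γ i) j≤Fi)))
                    (subst₂ _≤_ (sym (FaceOfRank.∣edges∣≡ (clamped i))) (sym (FaceOfRank.∣edges∣≡ (clamped j)))
                            (⊓-monoˡ-≤ q i≤j))

    K-step : ∀ i → K i ⊆ K (suc i)
    K-step i = proj₁ (face≤face⁻ (γ i) (γ (suc i)) (K-mono i (suc i) (n≤1+n i)))

    -- opaque: unfolding this construction makes type checking blow up
    opaque
      σ : Perm q
      σ = proj₁ (fullChain⇒prefixes K K-step ∣K∣≡)

      prefix-σ : ∀ r → prefix σ r ≡ K r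
      prefix-σ = proj₂ (fullChain⇒prefixes K K-step ∣K∣≡)

    α : Perm p
    α = γ 0

    flagFace≈ : ∀ r → flagFace α σ r ≈F face (K r) (γ r)
    flagFace≈ r = face≈face⁺ (prefix-σ r) (subst (λ L → SameCoset L α (γ r)) (sym (prefix-σ r))
                                                   (proj₂ (face≤face⁻ α (γ r) (K-mono 0 r z≤n))))

    flag⊆Φ : ∀ x → x ∈L flag α σ → x ∈L Φ
    flag⊆Φ x (here x≈bot) = ∈L-resp {bot} {x} (≈F-sym {x} {bot} x≈bot) bot∈Φ
    flag⊆Φ x (there x∈) with ∈flag⁻ α σ x∈
    ... | i , _ , x≈ =
      ∈L-resp {face (K i) (γ i)} {x}
        (≈F-sym {x} {face (K i) (γ i)} (≈F-trans {x} {flagFace α σ i} {face (K i) (γ i)} x≈ (flagFace≈ i)))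
        (K∈Φ i)

    Φ⊆flag : ∀ x → x ∈L Φ → x ∈L flag α σ
    Φ⊆flag x x∈Φ = flag-maximal α σ x (All.tabulate λ {y} y∈ →
      chain⇒comparable chain x∈Φ (flag⊆Φ y (Any.map (λ { refl → ≈F-refl {y} }) y∈)))

    flag≈Φ : Pointwise _≈F_ (flag α σ) Φ
    flag≈Φ = sameMembers⇒Pointwise (flag-isChain α σ) chain flag⊆Φ Φ⊆flag

  flag-surjective : ∀ Φ → IsFlag Φ → ∃₂ λ α σ → Pointwise _≈F_ (flag α σ) Φ
  flag-surjective Φ Φ-isFlag = Canonical.α Φ Φ-isFlag , Canonical.σ Φ Φ-isFlag , Canonical.flag≈Φ Φ Φ-isFlag

  flag-injective : ∀ {α α′ σ σ′} → Pointwise _≈F_ (flag α σ) (flag α′ σ′) → α ≋ α′ × σ ≋ σ′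
  flag-injective {α} {α′} {σ} {σ′} (_ ∷ same) =
    SameCoset-⊥⇒≋ (subst (λ K → SameCoset K α α′) (prefix-zero σ) (proj₂ (face≈face⁻ α α′ (same-at z≤n)))) ,
    prefix-injective (λ r r≤q → proj₁ (face≈face⁻ α α′ (same-at r≤q)))
    where
    same-at : ∀ {r} → r ≤ q → flagFace α σ r ≈F flagFace α′ σ′ r
    same-at r≤q = applyUpTo-Pointwise⁻ (flagFace α σ) (flagFace α′ σ′) (suc q) same (s≤s r≤q)


module FlagConnectivity {p q : ℕ} (G : SimpleGraph p q) (connected : Connected G) where
  open Permutations
  open FinSubsets
  open PrefixSubsets
  open EdgeSubgroups G
  open GraphicahedronOrder G
  open import Data.Nat using (zero; suc; _+_; _≤_; _<_; _≟_; z≤n; s≤s)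
  open import Data.Nat.Properties
    using (suc-injective; <-irrefl; <⇒≤; ≤-refl; ≤-reflexive; ≤-trans; <-≤-trans; ≤-<-trans; ≤-pred;
           m≤n⇒m<n∨m≡n; m≤n⇒m≤1+n; n≢0⇒n>0; +-suc; +-identityʳ; m≤n+m; m<n+m; <-cmp)
  open import Data.Fin using (Fin; toℕ; fromℕ<)
  open import Data.Fin.Properties using (toℕ-fromℕ<; toℕ<n; toℕ-injective)
  open import Data.Fin.Permutation using (_⟨$⟩ʳ_; _⟨$⟩ˡ_; flip; inverseʳ)
  open import Data.Fin.Subset using (_∈_; ⊥)
  open import Data.List using ([]; _∷_)
  open import Data.List.Relation.Unary.Any using (here; there)
  open import Data.List.Relation.Unary.All using (All; []; _∷_)
  open import Data.List.Relation.Binary.Pointwise using (Pointwise)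
  open import Data.Product using (∃; ∃₂; proj₁; proj₂)
  open import Data.Sum using (inj₁; inj₂)
  open import Data.Empty using (⊥-elim)
  open import Relation.Nullary using (¬_; yes; no)
  open import Relation.Unary using (Decidable)
  open import Relation.Binary.PropositionalEquality hiding (resp)
  open import Relation.Binary.Definitions using (tri<; tri≈; tri>)
  import Data.Bool as Bool
  open import Data.Vec.Properties using (≡-dec)

  least : ∀ {P : ℕ → Set} → Decidable P → ∀ {n} → P n → ∃ λ c → c ≤ n × P c × (∀ {i} → i < c → ¬ P i)
  least {P} P? {n} Pn = search n 0 (+-identityʳ n) (λ ())
    where
    search : ∀ k r → k + r ≡ n → (∀ {i} → i < r → ¬ P i) → ∃ λ c → c ≤ n × P c × (∀ {i} → i < c → ¬ P i)
    search k r k+r≡n below with P? r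
    ... | yes Pr = r , subst (r ≤_) k+r≡n (m≤n+m r k) , Pr , below
    search zero r refl below | no ¬Pr = ⊥-elim (¬Pr Pn)
    search (suc k) r k+r≡n below | no ¬Pr = search k (suc r) (trans (+-suc k r) k+r≡n) below′
      where
      below′ : ∀ {i} → i < suc r → ¬ P i
      below′ i<1+r with m≤n⇒m<n∨m≡n (≤-pred i<1+r)
      ... | inj₁ i<r = below i<r
      ... | inj₂ refl = ¬Pr

  flagFace-rank-unique : ∀ {γ σ γ′ σ′ i j x} → i ≤ q → j ≤ q →
                         x ≈F flagFace γ σ i → x ≈F flagFace γ′ σ′ j → i ≡ j
  flagFace-rank-unique {γ} {σ} {γ′} {σ′} {i} {j} {x} i≤q j≤q x≈i x≈j = suc-injective (begin
    suc i                           ≡⟨ height-flagFace γ σ i≤q ⟨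
    height (flagFace γ σ i)         ≡⟨ height-resp {x} x≈i ⟨
    height x                        ≡⟨ height-resp {x} x≈j ⟩
    height (flagFace γ′ σ′ j)       ≡⟨ height-flagFace γ′ σ′ j≤q ⟩
    suc j                           ∎)
    where open ≡-Reasoning

  record Adjacent (r : ℕ) (γ : Perm p) (σ : Perm q) (γ′ : Perm p) (σ′ : Perm q) : Set where
    constructor adjacent
    field
      r≤q : r ≤ q
      same : ∀ {i} → i ≤ q → i ≢ r → flagFace γ σ i ≈F flagFace γ′ σ′ i
      differs : ¬ (flagFace γ σ r ≈F flagFace γ′ σ′ r)

  Adjacent-sym : ∀ {r γ σ γ′ σ′} → Adjacent r γ σ γ′ σ′ → Adjacent r γ′ σ′ γ σ
  Adjacent-sym {r} {γ} {σ} {γ′} {σ′} (adjacent r≤q same differs) =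
    adjacent r≤q (λ {i} i≤q i≢r → ≈F-sym {flagFace γ σ i} {flagFace γ′ σ′ i} (same i≤q i≢r))
                 (λ r′≈r → differs (≈F-sym {flagFace γ′ σ′ r} {flagFace γ σ r} r′≈r))

  Adjacent⇒DifferInOne : ∀ {r γ σ γ′ σ′} → Adjacent r γ σ γ′ σ′ → DifferInOne (flag γ σ) (flag γ′ σ′)
  Adjacent⇒DifferInOne adj = only-difference adj , only-difference (Adjacent-sym adj)
    where
    only-difference : ∀ {r γ σ γ′ σ′} → Adjacent r γ σ γ′ σ′ →
      ∃ λ a → a ∈L flag γ σ × ¬ (a ∈L flag γ′ σ′) × (∀ x → x ∈L flag γ σ → ¬ (x ∈L flag γ′ σ′) → x ≈F a)
    only-difference {r} {γ} {σ} {γ′} {σ′} (adjacent r≤q same differs) =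
      flagFace γ σ r , flagFace∈flag γ σ r≤q , ∉flag′ , unique
      where
      ∉flag′ : ¬ (flagFace γ σ r ∈L flag γ′ σ′)
      ∉flag′ (here ())
      ∉flag′ (there x∈) with ∈flag⁻ γ′ σ′ x∈
      ... | i , i≤q , r≈i
        with flagFace-rank-unique {γ} {σ} {γ′} {σ′} {r} {i} {flagFace γ σ r} r≤q i≤q (≈F-refl {flagFace γ σ r}) r≈i
      ... | refl = differs r≈i
      unique : ∀ x → x ∈L flag γ σ → ¬ (x ∈L flag γ′ σ′) → x ≈F flagFace γ σ r
      unique x (here x≈bot) x∉ = ⊥-elim (x∉ (here x≈bot))
      unique x (there x∈) x∉ with ∈flag⁻ γ σ x∈
      ... | i , i≤q , x≈i with i ≟ r
      ...   | yes refl = x≈i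
      ...   | no i≢r =
        ⊥-elim (x∉ (∈L-resp (≈F-sym {x} (≈F-trans {x} x≈i (same i≤q i≢r))) (flagFace∈flag γ′ σ′ i≤q)))

  Adjacent-swapped : ∀ γ σ {i} (1+i<q : suc i < q) → Adjacent (suc i) γ σ γ (swapped σ 1+i<q)
  Adjacent-swapped γ σ 1+i<q =
    adjacent (<⇒≤ 1+i<q) (λ {r} _ r≢ → face≈face⁺ (sym (prefix-swapped σ 1+i<q r r≢)) (SameCoset-refl γ))
             (λ same → prefix-swapped-differs σ 1+i<q (sym (proj₁ (face≈face⁻ γ γ same))))

  Adjacent-vertexMove : ∀ γ σ (0<q : 0 < q) → Adjacent 0 γ σ (τ (σ ⟨$⟩ʳ fromℕ< 0<q) · γ) σ
  Adjacent-vertexMove γ σ 0<q = adjacent z≤n same differs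
    where
    e = σ ⟨$⟩ʳ fromℕ< 0<q
    same : ∀ {i} → i ≤ q → i ≢ 0 → flagFace γ σ i ≈F flagFace (τ e · γ) σ i
    same {i} _ i≢0 = face≈face⁺ {α = γ} {β = τ e · γ} refl (sameCoset (InT-resp τe≋ (gen e e∈)))
      where
      e∈ : e ∈ prefix σ i
      e∈ = position<⇒∈prefix σ (subst (_< i) (sym (trans (position-⟨$⟩ʳ σ _) (toℕ-fromℕ< 0<q))) (n≢0⇒n>0 i≢0))
      τe≋ : τ e ≋ γ · flip (τ e · γ)
      τe≋ = ⟪ (λ x → sym (trans (inverseʳ γ) (ap (flip-transpose (end₁ e) (end₂ e)) x))) ⟫
    differs : ¬ (flagFace γ σ 0 ≈F flagFace (τ e · γ) σ 0)
    differs same₀ = τ≉id e (≋-sym (·-cancelʳ γ {idₚ} {τ e} (SameCoset-⊥⇒≋ coset)))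
      where
      coset : SameCoset ⊥ γ (τ e · γ)
      coset = subst (λ K → SameCoset K γ (τ e · γ)) (prefix-zero σ) (proj₂ (face≈face⁻ γ (τ e · γ) same₀))

  module Connect (α : Perm p) (σ₀ : Perm q) (β : Perm p) (ρ : Perm q) where

    Common : ℕ → Set
    Common r = flagFace α σ₀ r ≈F flagFace β ρ r

    Common? : Decidable Common
    Common? r with ≡-dec Bool._≟_ (prefix σ₀ r) (prefix ρ r) | SameCoset? (prefix σ₀ r) α β
    ... | yes K≡L | yes s = yes (face≈face⁺ K≡L s)
    ... | no K≢L | _ = no (λ c → K≢L (proj₁ (face≈face⁻ α β c)))
    ... | yes _ | no ¬s = no (λ c → ¬s (proj₂ (face≈face⁻ α β c)))

    Keeps : Perm p → Perm q → Set
    Keeps γ σ = ∀ {r} → r ≤ q → Common r → flagFace γ σ r ≈F flagFace α σ₀ r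

    Keeps-Adjacent : ∀ {r γ σ γ′ σ′} → Keeps γ σ → Adjacent r γ σ γ′ σ′ → ¬ Common r → Keeps γ′ σ′
    Keeps-Adjacent {r} {γ} {σ} {γ′} {σ′} keeps (adjacent _ same _) ¬common {i} i≤q common with i ≟ r
    ... | yes refl = ⊥-elim (¬common common)
    ... | no i≢r = ≈F-trans {flagFace γ′ σ′ i} {flagFace γ σ i} {flagFace α σ₀ i}
                            (≈F-sym {flagFace γ σ i} {flagFace γ′ σ′ i} (same i≤q i≢r)) (keeps i≤q common)

    data Moves : Perm p → Perm q → Perm p → Perm q → Set where
      []   : ∀ {γ σ} → Moves γ σ γ σ
      move : ∀ {r γ σ γ′ σ′ γ″ σ″} → Adjacent r γ σ γ′ σ′ → ¬ Common r → Moves γ′ σ′ γ″ σ″ → Moves γ σ γ″ σ″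

    _++ᴹ_ : ∀ {γ σ γ′ σ′ γ″ σ″} → Moves γ σ γ′ σ′ → Moves γ′ σ′ γ″ σ″ → Moves γ σ γ″ σ″
    [] ++ᴹ ms = ms
    move adj ¬c ms ++ᴹ ms′ = move adj ¬c (ms ++ᴹ ms′)

    Keeps-Moves : ∀ {γ σ γ′ σ′} → Keeps γ σ → Moves γ σ γ′ σ′ → Keeps γ′ σ′
    Keeps-Moves keeps [] = keeps
    Keeps-Moves keeps (move adj ¬c ms) = Keeps-Moves (Keeps-Adjacent keeps adj ¬c) ms

    Keeps⇒ContainsMeet : ∀ {γ σ} → Keeps γ σ → ContainsMeet (flag α σ₀) (flag β ρ) (flag γ σ)
    Keeps⇒ContainsMeet keeps x (here x≈bot) _ = here x≈bot
    Keeps⇒ContainsMeet keeps x (there _) (here x≈bot) = here x≈bot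
    Keeps⇒ContainsMeet {γ} {σ} keeps x (there x∈Φ) (there x∈Ψ) with ∈flag⁻ α σ₀ x∈Φ | ∈flag⁻ β ρ x∈Ψ
    ... | i , i≤q , x≈Φi | j , j≤q , x≈Ψj
      with flagFace-rank-unique {α} {σ₀} {β} {ρ} {i} {j} {x} i≤q j≤q x≈Φi x≈Ψj
    ... | refl = ∈L-resp (≈F-trans {flagFace γ σ i} (keeps i≤q common) (≈F-sym {x} x≈Φi)) (flagFace∈flag γ σ i≤q)
      where
      common : Common i
      common = ≈F-trans {flagFace α σ₀ i} {x} (≈F-sym {x} x≈Φi) x≈Ψj

    Moves⇒FlagSeq : ∀ {γ σ γ′ σ′} → Keeps γ σ → Moves γ σ γ′ σ′ → Pointwise _≈F_ (flag γ′ σ′) (flag β ρ) →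
                    FlagSeq (flag α σ₀) (flag β ρ) (flag γ σ)
    Moves⇒FlagSeq keeps [] end = done end
    Moves⇒FlagSeq keeps (move {γ′ = γ′} {σ′ = σ′} adj ¬c ms) end =
      step (flag-isFlag γ′ σ′) (Adjacent⇒DifferInOne adj) (Keeps⇒ContainsMeet {γ′} {σ′} keeps′)
           (Moves⇒FlagSeq keeps′ ms end)
      where
      keeps′ : Keeps γ′ σ′
      keeps′ = Keeps-Adjacent keeps adj ¬c

    -- Edge e moves down from position j to position k by adjacent swaps,
    -- provided none of the ranks it passes is common.
    record Brought (γ : Perm p) (σ : Perm q) (e : Fin q) (k : ℕ) : Set where
      field
        σ′ : Perm q
        moves : Moves γ σ γ σ′
        position≡k : position σ′ e ≡ k
        unchanged-below : ∀ x → toℕ x < k → σ′ ⟨$⟩ʳ x ≡ σ ⟨$⟩ʳ x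

    bring : ∀ γ σ e k j → position σ e ≡ j → k ≤ j → Keeps γ σ →
            (∀ σ′ i → k ≤ i → suc i ≤ j → Keeps γ σ′ → position σ′ e ≡ suc i → ¬ Common (suc i)) →
            Brought γ σ e k
    bring γ σ e k zero at-j z≤n _ _ = record { σ′ = σ ; moves = [] ; position≡k = at-j ; unchanged-below = λ _ () }
    bring γ σ e k (suc j) at-j k≤j keeps passable with m≤n⇒m<n∨m≡n k≤j
    ... | inj₂ refl = record { σ′ = σ ; moves = [] ; position≡k = at-j ; unchanged-below = λ _ _ → refl }
    ... | inj₁ k<1+j = record
      { σ′ = Brought.σ′ rest
      ; moves = move (Adjacent-swapped γ σ 1+j<q) ¬common [] ++ᴹ Brought.moves rest
      ; position≡k = Brought.position≡k rest
      ; unchanged-below = λ x x<k → trans (Brought.unchanged-below rest x x<k)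
                                          (swapped-below σ 1+j<q x (<-≤-trans x<k (≤-pred k<1+j))) }
      where
      1+j<q : suc j < q
      1+j<q = subst (_< q) at-j (toℕ<n (σ ⟨$⟩ˡ e))
      ¬common : ¬ Common (suc j)
      ¬common = passable σ j (≤-pred k<1+j) ≤-refl keeps at-j
      e≡ : e ≡ σ ⟨$⟩ʳ fromℕ< 1+j<q
      e≡ = trans (sym (inverseʳ σ)) (cong (σ ⟨$⟩ʳ_) (toℕ-injective (trans at-j (sym (toℕ-fromℕ< 1+j<q)))))
      rest = bring γ (swapped σ 1+j<q) e k j
                   (trans (cong (position (swapped σ 1+j<q)) e≡) (position-swapped σ 1+j<q))
                   (≤-pred k<1+j) (Keeps-Adjacent keeps (Adjacent-swapped γ σ 1+j<q) ¬common)
                   (λ σ′ i k≤i 1+i≤j → passable σ′ i k≤i (m≤n⇒m≤1+n 1+i≤j))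

    -- With c the least common rank, the vertex β α⁻¹ ∈ T_K (K the common
    -- edge set of rank c) is reached letter by letter: each generator τ w
    -- is applied by bringing w to position 0 (swaps of rank ≤ c) and moving
    -- the vertex along it.
    module VertexPhase {c} (c≤q : c ≤ q) (common-c : Common c) (below-c : ∀ {i} → i < c → ¬ Common i) where

      letter : ∀ γ σ w → Keeps γ σ → w ∈ prefix σ₀ c →
               ∃₂ λ γ′ σ′ → Moves γ σ γ′ σ′ × γ′ ≋ τ w · γ
      letter γ σ w keeps w∈ = τ (σ′ ⟨$⟩ʳ fromℕ< 0<q) · γ , σ′ ,
        Brought.moves brought ++ᴹ move (Adjacent-vertexMove γ σ′ 0<q) (below-c 0<c) [] ,
        ·-congˡ γ (subst (λ e → τ e ≋ τ w) (sym w-first) ≋-refl)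
        where
        prefix≡ : prefix σ c ≡ prefix σ₀ c
        prefix≡ = proj₁ (face≈face⁻ γ α (keeps c≤q common-c))
        w<c : position σ w < c
        w<c = ∈prefix⇒position< σ (subst (w ∈_) (sym prefix≡) w∈)
        0<c : 0 < c
        0<c = ≤-<-trans z≤n w<c
        0<q : 0 < q
        0<q = <-≤-trans 0<c c≤q
        brought = bring γ σ w 0 (position σ w) refl z≤n keeps (λ _ i _ 1+i≤j _ _ → below-c (≤-<-trans 1+i≤j w<c))
        σ′ = Brought.σ′ brought
        w-first : σ′ ⟨$⟩ʳ fromℕ< 0<q ≡ w
        w-first = trans (cong (σ′ ⟨$⟩ʳ_)
                                (toℕ-injective (trans (toℕ-fromℕ< 0<q) (sym (Brought.position≡k brought)))))
                        (inverseʳ σ′)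

      word : ∀ ws → All (_∈ prefix σ₀ c) ws → ∀ γ σ → Keeps γ σ →
             ∃₂ λ γ′ σ′ → Moves γ σ γ′ σ′ × γ′ ≋ τ-product ws · γ
      word [] _ γ σ _ = γ , σ , [] , ≋-refl
      word (w ∷ ws) (w∈ ∷ ws∈) γ σ keeps with word ws ws∈ γ σ keeps
      ... | γ₁ , σ₁ , ms₁ , γ₁≋ with letter γ₁ σ₁ w (Keeps-Moves keeps ms₁) w∈
      ...   | γ₂ , σ₂ , ms₂ , γ₂≋ = γ₂ , σ₂ , ms₁ ++ᴹ ms₂ , ≋-trans γ₂≋ (·-congʳ (τ w) γ₁≋)

    -- With the vertex at β, bubble-sort σ into ρ: placing ρ k at position k
    -- only swaps at ranks whose prefix of σ misses ρ k, which are not common.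
    module SortPhase (γ : Perm p) (γ≋β : γ ≋ β) where

      Sorted : ℕ → Perm q → Set
      Sorted k σ = ∀ x → toℕ x < k → σ ⟨$⟩ʳ x ≡ ρ ⟨$⟩ʳ x

      sortStep : ∀ σ {k} (k<q : k < q) → Keeps γ σ → Sorted k σ → ∃ λ σ′ → Moves γ σ γ σ′ × Sorted (suc k) σ′
      sortStep σ {k} k<q keeps sorted = Brought.σ′ brought , Brought.moves brought , sorted′
        where
        e = ρ ⟨$⟩ʳ fromℕ< k<q
        position-ρ : position ρ e ≡ k
        position-ρ = trans (position-⟨$⟩ʳ ρ _) (toℕ-fromℕ< k<q)
        k≤position : k ≤ position σ e
        k≤position with <-cmp (position σ e) k
        ... | tri< e<k _ _ = ⊥-elim (<-irrefl (trans (cong toℕ x≡k) (toℕ-fromℕ< k<q)) e<k)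
          where
          x≡k : σ ⟨$⟩ˡ e ≡ fromℕ< k<q
          x≡k = ⟨$⟩ʳ-injective ρ (trans (sym (sorted (σ ⟨$⟩ˡ e) e<k)) (inverseʳ σ))
        ... | tri≈ _ e≡k _ = ≤-reflexive (sym e≡k)
        ... | tri> _ _ e>k = <⇒≤ e>k
        passable : ∀ σ′ i → k ≤ i → suc i ≤ position σ e → Keeps γ σ′ → position σ′ e ≡ suc i → ¬ Common (suc i)
        passable σ′ i k≤i 1+i≤ keeps′ at common =
          <-irrefl at (∈prefix⇒position< σ′ (subst (e ∈_) (sym prefix≡) (position<⇒∈prefix ρ e<1+i)))
          where
          1+i≤q : suc i ≤ q
          1+i≤q = ≤-trans 1+i≤ (<⇒≤ (toℕ<n (σ ⟨$⟩ˡ e)))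
          prefix≡ : prefix σ′ (suc i) ≡ prefix ρ (suc i)
          prefix≡ = proj₁ (face≈face⁻ γ β
            (≈F-trans {flagFace γ σ′ (suc i)} {flagFace α σ₀ (suc i)} {flagFace β ρ (suc i)} (keeps′ 1+i≤q common) common))
          e<1+i : position ρ e < suc i
          e<1+i = subst (_< suc i) (sym position-ρ) (s≤s k≤i)
        brought = bring γ σ e k (position σ e) refl k≤position keeps passable
        sorted′ : Sorted (suc k) (Brought.σ′ brought)
        sorted′ x x<1+k with m≤n⇒m<n∨m≡n (≤-pred x<1+k)
        ... | inj₁ x<k = trans (Brought.unchanged-below brought x x<k) (sorted x x<k)
        ... | inj₂ x≡k with toℕ-injective {i = x} {j = fromℕ< k<q} (trans x≡k (sym (toℕ-fromℕ< k<q)))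
        ...   | refl = trans (cong (Brought.σ′ brought ⟨$⟩ʳ_)
                                   (toℕ-injective (trans (toℕ-fromℕ< k<q) (sym (Brought.position≡k brought)))))
                             (inverseʳ (Brought.σ′ brought))

      sortFrom : ∀ n {k} → n + k ≡ q → ∀ σ → Keeps γ σ → Sorted k σ → ∃ λ σ′ → Moves γ σ γ σ′ × σ′ ≋ ρ
      sortFrom zero refl σ _ sorted = σ , [] , ⟪ (λ x → sorted x (toℕ<n x)) ⟫
      sortFrom (suc n) {k} n+k≡q σ keeps sorted
        with sortStep σ (subst (k <_) n+k≡q (m<n+m k (s≤s z≤n))) keeps sorted
      ... | σ₁ , ms₁ , sorted₁ with sortFrom n (trans (+-suc n k) n+k≡q) σ₁ (Keeps-Moves keeps ms₁) sorted₁
      ...   | σ₂ , ms₂ , σ₂≋ρ = σ₂ , ms₁ ++ᴹ ms₂ , σ₂≋ρ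

    common-top : Common q
    common-top = face≈face⁺ (trans (prefix-full σ₀) (sym (prefix-full ρ)))
                            (subst (λ K → SameCoset K α β) (sym (prefix-full σ₀)) (SameCoset-⊤ connected α β))

    flagSeq : FlagSeq (flag α σ₀) (flag β ρ) (flag α σ₀)
    flagSeq =
      let c , c≤q , common-c , below-c = least Common? common-top
          ws , ws⊆K , ws≋βα⁻¹ = InT⇒τ-product (quotient∈T (SameCoset-sym (proj₂ (face≈face⁻ α β common-c))))
          γ , σ , ms₁ , γ≋ = VertexPhase.word c≤q common-c below-c ws ws⊆K α σ₀ keeps₀
          γ≋β = ≋-trans γ≋ (≋-trans (·-congˡ α ws≋βα⁻¹) (≋-trans (·-assoc β (flip α) α)
                  (≋-trans (·-congʳ β (·-inverseˡ α)) (·-identityʳ β))))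
          _ , ms₂ , σ′≋ρ = SortPhase.sortFrom γ γ≋β q (+-identityʳ q) σ (Keeps-Moves keeps₀ ms₁) (λ _ ())
      in Moves⇒FlagSeq keeps₀ (ms₁ ++ᴹ ms₂) (flag-cong γ≋β σ′≋ρ)
      where
      keeps₀ : Keeps α σ₀
      keeps₀ {r} _ _ = ≈F-refl {flagFace α σ₀ r}


module GraphicahedronProperties {p q : ℕ} (G : SimpleGraph p q) (connected : Connected G) where
  open Permutations
  open FinSubsets
  open PrefixSubsets
  open PermutationEnumeration
  open EdgeSubgroups G
  open GraphicahedronOrder G
  open FlagClassification G
  open import Data.Nat using (zero; suc; _+_; _≤_; z≤n)
  open import Data.Nat.Properties using (+-comm; 0≢1+n; 1+n≢n)
  open import Data.Integer as ℤ using (-[1+_]; -1ℤ; 1ℤ; _-_) renaming (_≤_ to _≤ℤ_)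
  open import Data.Integer.Properties using (+-injective)
  open import Data.Fin using (Fin; combine; remQuot)
  open import Data.Fin.Properties using (remQuot-combine; combine-remQuot)
  open import Data.Fin.Permutation using (_⟨$⟩ʳ_; flip; inverseˡ; inverseʳ)
  open import Data.Fin.Subset using (_∈_; _∉_; _⊆_; ∣_∣; ⁅_⁆; _∪_; ⊤; ⊥)
  open import Data.Fin.Subset.Properties using (⊆⊤; ⊥⊆; ∣⊥∣≡0; ∣p∣≤n; p⊆p∪q; x∈⁅x⁆)
  open import Data.List using (List; length)
  open import Data.List.Relation.Binary.Pointwise using (Pointwise; Pointwise-length)
  open import Data.Unit using (tt)
  open import Data.Product using (∃; proj₁; proj₂)
  open import Data.Sum using (_⊎_; inj₁; inj₂)
  open import Data.Empty using (⊥-elim)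
  open import Relation.Nullary using (¬_)
  open import Relation.Binary.PropositionalEquality hiding (resp)
  open import Function.Bundles using (_⇔_; mk⇔)
  open import Function using (_∘′_)

  rankF-resp : ∀ x y → x ≈F y → rankF x ≡ rankF y
  rankF-resp bot bot _ = refl
  rankF-resp (face _ _) (face _ _) (K≡L , _) = cong (+_ ∘′ ∣_∣) K≡L

  rankF-range : ∀ x → -1ℤ ≤ℤ rankF x × rankF x ≤ℤ + q
  rankF-range bot = ℤ.-≤- z≤n , ℤ.-≤+
  rankF-range (face K _) = ℤ.-≤+ , ℤ.+≤+ (∣p∣≤n K)

  rankF-onto : ∀ r → -1ℤ ≤ℤ r → r ≤ℤ + q → ∃ λ x → rankF x ≡ r
  rankF-onto -[1+ zero ] _ _ = bot , refl
  rankF-onto -[1+ suc n ] (ℤ.-≤- ()) _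
  rankF-onto (+ n) _ (ℤ.+≤+ n≤q) = face (prefix idₚ n) idₚ , cong +_ (∣prefix∣≡ idₚ n n≤q)

  greatest : ∃ λ top → ∀ x → x ≤F top
  greatest = face ⊤ idₚ , λ { bot → tt ; (face K α) → face≤face⁺ ⊆⊤ (SameCoset-⊤ connected α idₚ) }

  flag-size : ∀ Φ → IsFlag Φ → length Φ ≡ q + 2
  flag-size Φ Φ-isFlag with flag-surjective Φ Φ-isFlag
  ... | α , σ , flag≈Φ = trans (sym (Pointwise-length flag≈Φ)) (length-flag α σ)

  flag-connected : StronglyFlagConnected
  flag-connected Φ Ψ Φ-isFlag Ψ-isFlag with flag-surjective Φ Φ-isFlag | flag-surjective Ψ Ψ-isFlag
  ... | α , σ , flag≈Φ | β , ρ , flag≈Ψ =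
    FlagSeq-Pointwise flag≈Φ flag≈Ψ (FlagConnectivity.Connect.flagSeq G connected α σ β ρ)

  rankF≡0⇒edges≡⊥ : ∀ {K α} → rankF (face K α) ≡ + 0 → K ≡ ⊥
  rankF≡0⇒edges≡⊥ rank≡0 = ∣p∣≡0⇒p≡⊥ (+-injective rank≡0)

  vertex≈⇒≋ : ∀ {α β} → face ⊥ α ≈F face ⊥ β → α ≋ β
  vertex≈⇒≋ {α} {β} α≈β = SameCoset-⊥⇒≋ (proj₂ (face≈face⁻ α β α≈β))

  ∣∣≢⇒face≉face : ∀ {K L} α β → ∣ K ∣ ≢ ∣ L ∣ → ¬ (face K α ≈F face L β)
  ∣∣≢⇒face≉face _ _ ∣K∣≢∣L∣ (K≡L , _) = ∣K∣≢∣L∣ (cong ∣_∣ K≡L)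

  diamond-faces : ∀ K L α β → face K α <F face L β → ∣ L ∣ ≡ suc (suc ∣ K ∣) →
                  ExactlyTwoBetween (face K α) (face L β) (+ suc ∣ K ∣)
  diamond-faces K L α β K<L ∣L∣≡ = face (K ∪ ⁅ a ⁆) α , face (K ∪ ⁅ b ⁆) α ,
    between a a∉p p∪⁅a⁆⊆q , between b b∉p p∪⁅b⁆⊆q , a-b-differ , only-two
    where
    K⊆L = proj₁ (face≤face⁻ α β (proj₁ K<L))
    open SubsetDiamond (subsetDiamond K⊆L ∣L∣≡)
    between : ∀ c → c ∉ K → K ∪ ⁅ c ⁆ ⊆ L →
              face K α <F face (K ∪ ⁅ c ⁆) α × face (K ∪ ⁅ c ⁆) α <F face L β × + ∣ K ∪ ⁅ c ⁆ ∣ ≡ + suc ∣ K ∣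
    between c c∉K Kc⊆L =
      (face≤face⁺ (p⊆p∪q _) (SameCoset-refl α) ,
       ∣∣≢⇒face≉face α α (λ eq → 1+n≢n (sym (trans eq ∣Kc∣≡)))) ,
      (face≤face⁺ Kc⊆L (proj₂ (face≤face⁻ α β (proj₁ K<L))) ,
       ∣∣≢⇒face≉face α β (λ eq → 1+n≢n (sym (trans (sym ∣Kc∣≡) (trans eq ∣L∣≡))))) ,
      cong +_ ∣Kc∣≡
      where
      ∣Kc∣≡ : ∣ K ∪ ⁅ c ⁆ ∣ ≡ suc ∣ K ∣
      ∣Kc∣≡ = x∉p⇒∣p∪⁅x⁆∣≡1+∣p∣ K c∉K
    a-b-differ : ¬ (face (K ∪ ⁅ a ⁆) α ≈F face (K ∪ ⁅ b ⁆) α)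
    a-b-differ same with x∈p∪⁅y⁆⇒x∈p⊎x≡y b (subst (a ∈_) (proj₁ (face≈face⁻ α α same)) (y∈p∪⁅y⁆ a))
    ... | inj₁ a∈K = a∉p a∈K
    ... | inj₂ a≡b = a≢b a≡b
    only-two : ∀ g → face K α <F g × g <F face L β × rankF g ≡ + suc ∣ K ∣ →
               g ≈F face (K ∪ ⁅ a ⁆) α ⊎ g ≈F face (K ∪ ⁅ b ⁆) α
    only-two (face M γ) (K<M , M<L , rank≡)
      with face≤face⁻ α γ (proj₁ K<M) | face≤face⁻ γ β (proj₁ M<L)
    ... | K⊆M , αγ | M⊆L , _ with only-a-b M K⊆M M⊆L (+-injective rank≡)
    ...   | inj₁ M≡ = inj₁ (face≈face⁺ M≡ (SameCoset-sym αγ))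
    ...   | inj₂ M≡ = inj₂ (face≈face⁺ M≡ (SameCoset-sym αγ))

  diamond-edge : ∀ L β → ∣ L ∣ ≡ 1 → ExactlyTwoBetween bot (face L β) (+ 0)
  diamond-edge L β ∣L∣≡1 with ∣p∣≡1⇒p≡⁅x⁆ {p = L} ∣L∣≡1
  ... | e , refl =
    face ⊥ β , face ⊥ (τ e · β) , vertex (SameCoset-refl β) , vertex τeβ~β , β≉τeβ , only-two
    where
    vertex : ∀ {γ} → SameCoset ⁅ e ⁆ γ β → bot <F face ⊥ γ × face ⊥ γ <F face ⁅ e ⁆ β × + ∣ ⊥ {q} ∣ ≡ + 0
    vertex {γ} γ~β =
      (tt , λ ()) ,
      (face≤face⁺ ⊥⊆ γ~β , ∣∣≢⇒face≉face γ β (λ eq → 0≢1+n (trans (sym (∣⊥∣≡0 q)) (trans eq ∣L∣≡1)))) ,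
      cong +_ (∣⊥∣≡0 q)
    τeβ~β : SameCoset ⁅ e ⁆ (τ e · β) β
    τeβ~β = sameCoset (InT-resp ⟪ (λ x → cong (τ e ⟨$⟩ʳ_) (sym (inverseʳ β))) ⟫ (gen e (x∈⁅x⁆ e)))
    β≉τeβ : ¬ (face ⊥ β ≈F face ⊥ (τ e · β))
    β≉τeβ same = τ≉id e (≋-sym (·-cancelʳ β {idₚ} {τ e} (vertex≈⇒≋ same)))
    only-two : ∀ g → bot <F g × g <F face ⁅ e ⁆ β × rankF g ≡ + 0 →
               g ≈F face ⊥ β ⊎ g ≈F face ⊥ (τ e · β)
    only-two (face M γ) (_ , M<e , rank≡0) with rankF≡0⇒edges≡⊥ {M} {γ} rank≡0
    ... | refl with InT-⁅e⁆ e (quotient∈T (proj₂ (face≤face⁻ γ β (proj₁ M<e))))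
    ...   | inj₁ γβ⁻¹≋id = inj₁ (face≈face⁺ {α = γ} {β = β} refl (≋⇒SameCoset (·flip≋id⇒≋ γβ⁻¹≋id)))
    ...   | inj₂ γβ⁻¹≋τe = inj₂ (face≈face⁺ {α = γ} {β = τ e · β} refl (≋⇒SameCoset
                              ⟪ (λ x → trans (cong (γ ⟨$⟩ʳ_) (sym (inverseˡ β))) (ap γβ⁻¹≋τe (β ⟨$⟩ʳ x))) ⟫))

  -1ℤ≡j-1⇒j≡0 : ∀ j → -1ℤ ≡ j - 1ℤ → j ≡ + 0
  -1ℤ≡j-1⇒j≡0 (+ zero) _ = refl

  +n≡j-1⇒j≡1+n : ∀ n j → + n ≡ j - 1ℤ → j ≡ + suc n
  +n≡j-1⇒j≡1+n n (+ suc m) eq = cong (+_ ∘′ suc) (sym (+-injective eq))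

  diamond : Diamond
  diamond bot bot _ _ _ (_ , bot≉bot) = ⊥-elim (bot≉bot tt)
  diamond bot (face L β) j rank-f rank-h _ with -1ℤ≡j-1⇒j≡0 j rank-f
  ... | refl = diamond-edge L β (+-injective rank-h)
  diamond (face K α) (face L β) j rank-f rank-h f<h with +n≡j-1⇒j≡1+n ∣ K ∣ j rank-f
  ... | refl = diamond-faces K L α β f<h (trans (+-injective rank-h) (+-comm (suc ∣ K ∣) 1))

  isAbstractPolytope : IsAbstractPolytope q
  isAbstractPolytope = record
    { isPartialOrder = ≤F-isPartialOrder
    ; rank-resp = rankF-resp
    ; rank-strict = <F⇒rank<
    ; rank-range = rankF-range
    ; rank-onto = rankF-onto
    ; least = bot , λ _ → tt
    ; greatest = greatest
    ; flag-size = flag-size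
    ; flag-connected = flag-connected
    ; diamond = diamond }

  -- the faces above the vertex (⊥, α) are the (S, α), ordered as the S
  isSimple : IsSimple q
  isSimple (face K α) rank≡0 with rankF≡0⇒edges≡⊥ {K} {α} rank≡0
  ... | refl = (λ S → face S α) , (λ S → face≤face⁺ ⊥⊆ (SameCoset-refl α)) ,
               (λ S T → mk⇔ (λ (S⊆T : S ⊆ T) → face≤face⁺ {S} {T} (λ {x} → S⊆T {x}) (SameCoset-refl α)) proj₁) ,
               λ { (face L β) ⊥≤L → L , face≈face⁺ refl (proj₂ (face≤face⁻ α β ⊥≤L)) }

  vertexCount : NumFacesWith (λ v → rankF v ≡ + 0) (p !)
  vertexCount = (λ i → face ⊥ (enumerate p i)) , (λ _ → cong +_ (∣⊥∣≡0 q)) ,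
    (λ i j same → enumerate-injective p (vertex≈⇒≋ same)) ,
    λ { (face K α) rank≡0 → index p α ,
          face≈face⁺ (sym (rankF≡0⇒edges≡⊥ {K} {α} rank≡0)) (≋⇒SameCoset (enumerate-index p α)) }

  -- Fin (p ! * q !) indexes the pairs (α, σ)
  flagCount : NumFlags (p ! * q !)
  flagCount = flagAt , (λ i → flag-isFlag (vertexAt i) (orderAt i)) , injective , surjective
    where
    vertexAt : Fin (p ! * q !) → Perm p
    vertexAt i = enumerate p (proj₁ (remQuot {p !} (q !) i))
    orderAt : Fin (p ! * q !) → Perm q
    orderAt i = enumerate q (proj₂ (remQuot {p !} (q !) i))
    flagAt : Fin (p ! * q !) → List Face
    flagAt i = flag (vertexAt i) (orderAt i)
    injective : ∀ i j → Pointwise _≈F_ (flagAt i) (flagAt j) → i ≡ j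
    injective i j same = begin
      i                                             ≡⟨ combine-remQuot {p !} (q !) i ⟨
      combine (proj₁ (split i)) (proj₂ (split i))   ≡⟨ cong₂ combine (enumerate-injective p vertex≋)
                                                                     (enumerate-injective q order≋) ⟩
      combine (proj₁ (split j)) (proj₂ (split j))   ≡⟨ combine-remQuot {p !} (q !) j ⟩
      j                                             ∎
      where
      open ≡-Reasoning
      split = remQuot {p !} (q !)
      vertex≋ = proj₁ (flag-injective {vertexAt i} {vertexAt j} {orderAt i} {orderAt j} same)
      order≋ = proj₂ (flag-injective {vertexAt i} {vertexAt j} {orderAt i} {orderAt j} same)
    surjective : ∀ Φ → IsFlag Φ → ∃ λ i → Pointwise _≈F_ (flagAt i) Φ
    surjective Φ Φ-isFlag with flag-surjective Φ Φ-isFlag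
    ... | α , σ , flag≈Φ = combine (index p α) (index q σ) ,
      subst (λ r → Pointwise _≈F_ (flag (enumerate p (proj₁ r)) (enumerate q (proj₂ r))) Φ)
            (sym (remQuot-combine {p !} {q !} (index p α) (index q σ)))
            (Pointwise-trans (flag-cong (enumerate-index p α) (enumerate-index q σ)) flag≈Φ)

  act-identity : ∀ x → act idₚ x ≈F x
  act-identity bot = tt
  act-identity (face K α) = face≈face⁺ {α = α · idₚ} {β = α} refl (SameCoset-refl α)

  act-· : ∀ γ δ x → act (γ · δ) x ≈F act δ (act γ x)
  act-· γ δ bot = tt
  act-· γ δ (face K α) = face≈face⁺ {α = α · (γ · δ)} {β = (α · γ) · δ} refl (SameCoset-refl (α · (γ · δ)))

  act-cong : ∀ γ δ x → γ ≈ₚ δ → act γ x ≈F act δ x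
  act-cong γ δ bot _ = tt
  act-cong γ δ (face K α) γ≈δ = face≈face⁺ {α = α · γ} {β = α · δ} refl (≋⇒SameCoset (·-congʳ α {γ} {δ} ⟪ γ≈δ ⟫))

  act-automorphism : ∀ γ → IsAutomorphism (act γ)
  act-automorphism γ = preserves-≈ , preserves-≤ , surjective
    where
    preserves-≈ : ∀ x y → x ≈F y → act γ x ≈F act γ y
    preserves-≈ bot bot _ = tt
    preserves-≈ (face K α) (face L β) x≈y with face≈face⁻ α β x≈y
    ... | K≡L , α~β = face≈face⁺ K≡L (SameCoset-·ʳ γ α~β)
    preserves-≤ : ∀ x y → (x ≤F y) ⇔ (act γ x ≤F act γ y)
    preserves-≤ bot _ = mk⇔ (λ _ → tt) (λ _ → tt)
    preserves-≤ (face K α) bot = mk⇔ (λ ()) (λ ())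
    preserves-≤ (face K α) (face L β) = mk⇔
      (λ x≤y → let K⊆L , α~β = face≤face⁻ α β x≤y
               in face≤face⁺ K⊆L (SameCoset-·ʳ γ α~β))
      (λ x≤y → let K⊆L , αγ~βγ = face≤face⁻ (α · γ) (β · γ) x≤y
               in face≤face⁺ K⊆L (SameCoset-·ʳ⁻ {α = α} {β = β} γ αγ~βγ))
    surjective : ∀ y → ∃ λ x → act γ x ≈F y
    surjective bot = bot , tt
    surjective (face K β) =
      face K (β · flip γ) ,
      face≈face⁺ {α = (β · flip γ) · γ} {β = β} refl (≋⇒SameCoset ⟪ (λ _ → cong (β ⟨$⟩ʳ_) (inverseˡ γ)) ⟫)

  act-vertex : ∀ γ v → rankF v ≡ + 0 → rankF (act γ v) ≡ + 0
  act-vertex γ (face K α) rank≡0 = rank≡0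

  act-transitive : ∀ u v → rankF u ≡ + 0 → rankF v ≡ + 0 → ∃ λ γ → act γ u ≈F v
  act-transitive (face K α) (face L β) rank-u rank-v =
    flip α · β ,
    face≈face⁺ {α = α · (flip α · β)} {β = β}
               (trans (rankF≡0⇒edges≡⊥ {K} {α} rank-u) (sym (rankF≡0⇒edges≡⊥ {L} {β} rank-v)))
               (≋⇒SameCoset ⟪ (λ _ → inverseʳ α) ⟫)

  act-free : ∀ u v γ δ → rankF u ≡ + 0 → rankF v ≡ + 0 → act γ u ≈F v → act δ u ≈F v → γ ≈ₚ δ
  act-free (face K α) (face L β) γ δ rank-u _ γu≈v δu≈v with rankF≡0⇒edges≡⊥ {K} {α} rank-u
  ... | refl = ap (·-cancelˡ α {γ} {δ} (SameCoset-⊥⇒≋ (SameCoset-trans {β = β} (proj₂ (face≈face⁻ (α · γ) β γu≈v))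
                                                                (SameCoset-sym (proj₂ (face≈face⁻ (α · δ) β δu≈v))))))

theorem1 : (p q : ℕ) (G : SimpleGraph p q) → Connected G →
  let open Graphicahedron G
      open PolytopeNotions _≈F_ _≤F_ rankF
  in IsAbstractPolytope q
   × IsSimple q
   × NumFacesWith (λ v → rankF v ≡ + 0) (p !)
   × NumFlags (p ! * q !)
   × (∀ x → act idₚ x ≈F x)
   × (∀ γ δ x → act (γ · δ) x ≈F act δ (act γ x))
   × (∀ γ δ x → γ ≈ₚ δ → act γ x ≈F act δ x)
   × (∀ γ → IsAutomorphism (act γ))
   × (∀ γ v → rankF v ≡ + 0 → rankF (act γ v) ≡ + 0)
   × (∀ u v → rankF u ≡ + 0 → rankF v ≡ + 0 →
        Σ (Permutation′ p) λ γ → act γ u ≈F v)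
   × (∀ u v γ δ → rankF u ≡ + 0 → rankF v ≡ + 0 →
        act γ u ≈F v → act δ u ≈F v → γ ≈ₚ δ)
theorem1 p q G connected =
  isAbstractPolytope , isSimple , vertexCount , flagCount ,
  act-identity , act-· , act-cong , act-automorphism ,
  act-vertex , act-transitive , act-free
  where open GraphicahedronProperties G connected
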